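{- Let $\mathcal{C}$ be a cartesian closed 2-category and $h_2$ the interpretation of reductions of $\mathcal{V}(\mathcal{C})$ as 2-cells of $\mathcal{C}$. Any two permutation-equivalent reductions $\Gamma\vdash P\equiv Q\colon M\to N\colon A$ are mapped by $h_2$ to the same 2-cell of $\mathcal{C}$.
   Context: A cartesian closed 2-category is a 2-category $\mathcal{C}$ with chosen terminal object $1$ ($\mathcal{C}(D,1)\to1$ an isomorphism of categories for all $D$), a product 2-functor $\times$ with chosen projections such that $\mathcal{C}(D,A\times B)\to\mathcal{C}(D,A)\times\mathcal{C}(D,B)$ is an isomorphism of categories, and chosen exponentials $(B^A,\mathit{ev})$ such that currying gives isomorphisms of categories $\varphi\colon\mathcal{C}(D\times A,B)\cong\mathcal{C}(D,B^A)$. Types over $X_0$: $A,B::=x\mid1\mid A\times B\mid B^A$. $h_0$ interprets types over the objects of $\mathcal{C}$ via the chosen structure, contexts as products. $\mathcal{V}(\mathcal{C})$ is the 2-signature with sorts the objects, operations over $(G\vdash A)$ the morphisms $h_0(G)\to h_0(A)$, and rules over $(G\vdash M,N\colon A)$ the 2-cells $h_1(M)\Rightarrow h_1(N)$, where $h_1$ is the standard interpretation of simply-typed $\lambda$-terms (unit, products, functions; operations as constants; modulo $\beta\eta$) as morphisms (variables as projections, $c\langle\vec M\rangle$ as $c\circ\langle h_1\vec M\rangle$, $\lambda$ via $\varphi$, application via $\mathit{ev}$, pairing and projections via products). Reductions $\Gamma\vdash P\colon M\to N\colon A$ are generated by rule application $r\langle P_1,\ldots,P_n\rangle\colon M[\vec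 M]\to N[\vec N]$ (for $r$ over $(G\vdash M,N\colon A)$, $P_i\colon M_i\to N_i\colon G_i$), vertical composition $P;_{M_2}Q$, and term constructors lifted to reductions ($x$, $()$, $c\langle\vec P\rangle$, $\lambda x.P$, $PQ$, $(P,Q)$, $\pi P$, $\pi'P$); every term $M$ is a reduction $M\colon M\to M$. Substitution $P[Q]=P[N];M'[Q]$ for $Q\colon N\to N'$, $P\colon M\to M'$, where $M'[Q]$ replaces variables by the $Q_i$ and $P[N]$ substitutes terms, structurally. Permutation equivalence $\equiv$ is the least congruence on reductions of equal type containing: associativity of $;$, $M;P\equiv P\equiv P;N$ for $P\colon M\to N$; $(\lambda x.P)Q\equiv P[Q/x]$, $P\equiv\lambda x.(Px)$, $\pi(P,Q)\equiv P$, $\pi'(P,Q)\equiv Q$, $P\equiv(\pi P,\pi'P)$, $P\equiv()$ at type $1$; for a rule $r$ over $(\Gamma\vdash M_1,M_2\colon A)$ and tuples $P\colon N_1\to N_2$, $Q\colon N_2\to N_3$: $r\langle P;Q\rangle\equiv M_1[P];r\langle Q\rangle\equiv r\langle P\rangle;M_2[Q]$; and $c\langle-\rangle$, $\lambda x$, application, pairing, $\pi,\pi'$ commute with $;$ componentwise. $h_2$ sends a reduction to a 2-cell inductively: $x_i\mapsto\mathit{id}_{\pi_i}$; $()\mapsto\mathit{id}_!$; $c\langle\vec P\rangle\mapsto c$ whiskered with $\langle h_2\vec P\rangle$; $r\langle\vec P\rangle\mapsto r\ast\langle h_2\vec P\rangle$; $;\mapsto$ vertical composition; $\lambda x.P\mapsto\varphi(h_2P)$;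 $PQ\mapsto\mathit{ev}$ whiskered with $\langle h_2P,h_2Q\rangle$; $(P,Q)\mapsto\langle h_2P,h_2Q\rangle$; $\pi P,\pi'P\mapsto\pi,\pi'$ whiskered with $h_2P$. -}

module Defs where

open import Level using (Level; _⊔_) renaming (suc to lsuc)
open import Relation.Binary.PropositionalEquality
  using (_≡_; refl; sym; trans; cong; cong₂; subst; subst₂; module ≡-Reasoning)
open import Relation.Binary.HeterogeneousEquality using (_≅_)

-- Equalities of 1-cells and of 2-cells are propositional equality.
-- Equations between 2-cells whose boundaries agree only up to an equation
-- between 1-cells are stated by transporting along that equation.

record CC2Cat (o ℓ c : Level) : Set (lsuc (o ⊔ ℓ ⊔ c)) where
  infixr 9 _∘_
  infixr 8 _·_
  infixr 9 _∗_
  field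
    Obj  : Set o
    Hom  : Obj → Obj → Set ℓ
    Cell : ∀ {A B} → Hom A B → Hom A B → Set c

    id     : ∀ {A} → Hom A A
    _∘_    : ∀ {A B C} → Hom B C → Hom A B → Hom A C
    assoc  : ∀ {A B C D} {h : Hom C D} {g : Hom B C} {f : Hom A B} →
             (h ∘ g) ∘ f ≡ h ∘ (g ∘ f)
    identˡ : ∀ {A B} {f : Hom A B} → id ∘ f ≡ f
    identʳ : ∀ {A B} {f : Hom A B} → f ∘ id ≡ f

    id₂     : ∀ {A B} (f : Hom A B) → Cell f f
    _·_     : ∀ {A B} {f g h : Hom A B} → Cell g h → Cell f g → Cell f h
    ·-assoc : ∀ {A B} {f g h k : Hom A B} {γ : Cell h k} {β : Cell g h} {α : Cell f g} →
              (γ · β) · α ≡ γ · (β · α)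
    ·-identˡ : ∀ {A B} {f g : Hom A B} {α : Cell f g} → id₂ g · α ≡ α
    ·-identʳ : ∀ {A B} {f g : Hom A B} {α : Cell f g} → α · id₂ f ≡ α

    _∗_ : ∀ {A B C} {g g' : Hom B C} {f f' : Hom A B} →
          Cell g g' → Cell f f' → Cell (g ∘ f) (g' ∘ f')
    ∗-id : ∀ {A B C} {g : Hom B C} {f : Hom A B} → id₂ g ∗ id₂ f ≡ id₂ (g ∘ f)
    interchange : ∀ {A B C} {g g' g'' : Hom B C} {f f' f'' : Hom A B}
                  {β' : Cell g' g''} {β : Cell g g'} {α' : Cell f' f''} {α : Cell f f'} →
                  (β' · β) ∗ (α' · α) ≡ (β' ∗ α') · (β ∗ α)
    ∗-assoc : ∀ {A B C D} {h h' : Hom C D} {g g' : Hom B C} {f f' : Hom A B}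
              {γ : Cell h h'} {β : Cell g g'} {α : Cell f f'} →
              subst₂ Cell assoc assoc ((γ ∗ β) ∗ α) ≡ γ ∗ (β ∗ α)
    ∗-identˡ : ∀ {A B} {f f' : Hom A B} {α : Cell f f'} →
               subst₂ Cell identˡ identˡ (id₂ id ∗ α) ≡ α
    ∗-identʳ : ∀ {A B} {f f' : Hom A B} {α : Cell f f'} →
               subst₂ Cell identʳ identʳ (α ∗ id₂ id) ≡ α

    -- chosen terminal object: C(D,1) → 1 is an isomorphism of categories
    𝟏      : Obj
    !      : ∀ {D} → Hom D 𝟏
    !-η    : ∀ {D} (f : Hom D 𝟏) → f ≡ !
    !-η₂   : ∀ {D} (α : Cell {D} ! !) → α ≡ id₂ !

    -- chosen binary products: C(D,A×B) → C(D,A) × C(D,B), given by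
    -- whiskering with the chosen projections, is an isomorphism of
    -- categories with inverse ⟨_,_⟩ / ⟨_,_⟩₂
    _×_    : Obj → Obj → Obj
    π₁     : ∀ {A B} → Hom (A × B) A
    π₂     : ∀ {A B} → Hom (A × B) B
    ⟨_,_⟩  : ∀ {D A B} → Hom D A → Hom D B → Hom D (A × B)
    ×-β₁   : ∀ {D A B} {f : Hom D A} {g : Hom D B} → π₁ ∘ ⟨ f , g ⟩ ≡ f
    ×-β₂   : ∀ {D A B} {f : Hom D A} {g : Hom D B} → π₂ ∘ ⟨ f , g ⟩ ≡ g
    ×-η    : ∀ {D A B} {h : Hom D (A × B)} → ⟨ π₁ ∘ h , π₂ ∘ h ⟩ ≡ h
    ⟨_,_⟩₂ : ∀ {D A B} {f f' : Hom D A} {g g' : Hom D B} →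
             Cell f f' → Cell g g' → Cell ⟨ f , g ⟩ ⟨ f' , g' ⟩
    ×-β₁₂  : ∀ {D A B} {f f' : Hom D A} {g g' : Hom D B} {α : Cell f f'} {β : Cell g g'} →
             subst₂ Cell ×-β₁ ×-β₁ (id₂ π₁ ∗ ⟨ α , β ⟩₂) ≡ α
    ×-β₂₂  : ∀ {D A B} {f f' : Hom D A} {g g' : Hom D B} {α : Cell f f'} {β : Cell g g'} →
             subst₂ Cell ×-β₂ ×-β₂ (id₂ π₂ ∗ ⟨ α , β ⟩₂) ≡ β
    ×-η₂   : ∀ {D A B} {h h' : Hom D (A × B)} {γ : Cell h h'} →
             subst₂ Cell ×-η ×-η ⟨ id₂ π₁ ∗ γ , id₂ π₂ ∗ γ ⟩₂ ≡ γ

    -- chosen exponentials (B^A, ev): currying φ = cur / cur₂ is an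
    -- isomorphism of categories C(D×A,B) ≅ C(D,B^A), inverse to
    -- g ↦ ev ∘ (g × A)
    _^_    : Obj → Obj → Obj
    ev     : ∀ {A B} → Hom ((B ^ A) × A) B
    cur    : ∀ {D A B} → Hom (D × A) B → Hom D (B ^ A)
    cur₂   : ∀ {D A B} {f f' : Hom (D × A) B} → Cell f f' → Cell (cur f) (cur f')
    cur-β  : ∀ {D A B} {f : Hom (D × A) B} → ev ∘ ⟨ cur f ∘ π₁ , π₂ ⟩ ≡ f
    cur-η  : ∀ {D A B} {g : Hom D (B ^ A)} → cur (ev ∘ ⟨ g ∘ π₁ , π₂ ⟩) ≡ g
    cur-β₂ : ∀ {D A B} {f f' : Hom (D × A) B} {α : Cell f f'} →
             subst₂ Cell cur-β cur-β (id₂ ev ∗ ⟨ cur₂ α ∗ id₂ π₁ , id₂ π₂ ⟩₂) ≡ α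
    cur-η₂ : ∀ {D A B} {g g' : Hom D (B ^ A)} {γ : Cell g g'} →
             subst₂ Cell cur-η cur-η (cur₂ (id₂ ev ∗ ⟨ γ ∗ id₂ π₁ , id₂ π₂ ⟩₂)) ≡ γ

module Syntax {o ℓ c : Level} (𝒞 : CC2Cat o ℓ c) where
  open CC2Cat 𝒞

  infixr 7 _⇒_
  infixl 8 _⊗_
  infixl 5 _▸_

  data Ty : Set o where
    ι   : Obj → Ty
    𝟙   : Ty
    _⊗_ : Ty → Ty → Ty
    _⇒_ : Ty → Ty → Ty

  -- contexts (de Bruijn: the last variable is the most recent one)
  data Ctx : Set o where
    ε   : Ctx
    _▸_ : Ctx → Ty → Ctx

  data _∋_ : Ctx → Ty → Set o where
    zero : ∀ {Γ A} → (Γ ▸ A) ∋ A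
    suc  : ∀ {Γ A B} → Γ ∋ A → (Γ ▸ B) ∋ A

  variable
    Γ Δ Θ G : Ctx
    A B : Ty

  h₀ : Ty → Obj
  h₀ (ι X)   = X
  h₀ 𝟙       = 𝟏
  h₀ (A ⊗ B) = h₀ A × h₀ B
  h₀ (A ⇒ B) = h₀ B ^ h₀ A

  h₀c : Ctx → Obj
  h₀c ε       = 𝟏
  h₀c (Γ ▸ A) = h₀c Γ × h₀ A

  -- raw terms; operations over (G ⊢ A) are the morphisms h₀c G → h₀ A
  data Tm (Γ : Ctx) : Ty → Set (o ⊔ ℓ)
  data Sub (Γ : Ctx) : Ctx → Set (o ⊔ ℓ)

  data Tm Γ where
    var  : Γ ∋ A → Tm Γ A
    unit : Tm Γ 𝟙
    pair : Tm Γ A → Tm Γ B → Tm Γ (A ⊗ B)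
    fst  : Tm Γ (A ⊗ B) → Tm Γ A
    snd  : Tm Γ (A ⊗ B) → Tm Γ B
    lam  : Tm (Γ ▸ A) B → Tm Γ (A ⇒ B)
    app  : Tm Γ (A ⇒ B) → Tm Γ A → Tm Γ B
    op   : ∀ {G A} → Hom (h₀c G) (h₀ A) → Sub Γ G → Tm Γ A

  data Sub Γ where
    []  : Sub Γ ε
    _,_ : Sub Γ G → Tm Γ A → Sub Γ (G ▸ A)

  data Ren (Γ : Ctx) : Ctx → Set o where
    []  : Ren Γ ε
    _,_ : Ren Γ Δ → Γ ∋ A → Ren Γ (Δ ▸ A)

  lookupR : Ren Γ Δ → Δ ∋ A → Γ ∋ A
  lookupR (ρ , x) zero    = x
  lookupR (ρ , x) (suc y) = lookupR ρ y

  wkR : Ren Γ Δ → Ren (Γ ▸ B) Δ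
  wkR []      = []
  wkR (ρ , x) = wkR ρ , suc x

  liftR : Ren Γ Δ → Ren (Γ ▸ A) (Δ ▸ A)
  liftR ρ = wkR ρ , zero

  idR : Ren Γ Γ
  idR {ε}     = []
  idR {Γ ▸ A} = liftR idR

  wk : Ren (Γ ▸ A) Γ
  wk = wkR idR

  ren  : Ren Γ Δ → Tm Δ A → Tm Γ A
  rens : Ren Γ Δ → Sub Δ G → Sub Γ G
  ren ρ (var x)    = var (lookupR ρ x)
  ren ρ unit       = unit
  ren ρ (pair M N) = pair (ren ρ M) (ren ρ N)
  ren ρ (fst M)    = fst (ren ρ M)
  ren ρ (snd M)    = snd (ren ρ M)
  ren ρ (lam M)    = lam (ren (liftR ρ) M)
  ren ρ (app M N)  = app (ren ρ M) (ren ρ N)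
  ren ρ (op f σ)   = op f (rens ρ σ)
  rens ρ []      = []
  rens ρ (σ , M) = rens ρ σ , ren ρ M

  lookup : Sub Γ G → G ∋ A → Tm Γ A
  lookup (σ , M) zero    = M
  lookup (σ , M) (suc y) = lookup σ y

  liftS : Sub Γ Δ → Sub (Γ ▸ A) (Δ ▸ A)
  liftS σ = rens wk σ , var zero

  idS : Sub Γ Γ
  idS {ε}     = []
  idS {Γ ▸ A} = liftS idS

  sub  : Sub Γ Δ → Tm Δ A → Tm Γ A
  subs : Sub Γ Δ → Sub Δ G → Sub Γ G
  sub σ (var x)    = lookup σ x
  sub σ unit       = unit
  sub σ (pair M N) = pair (sub σ M) (sub σ N)
  sub σ (fst M)    = fst (sub σ M)
  sub σ (snd M)    = snd (sub σ M)
  sub σ (lam M)    = lam (sub (liftS σ) M)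
  sub σ (app M N)  = app (sub σ M) (sub σ N)
  sub σ (op f τ)   = op f (subs σ τ)
  subs σ []      = []
  subs σ (τ , M) = subs σ τ , sub σ M

  infix 4 _≈βη_ _≈βηs_
  data _≈βη_  {Γ : Ctx} : {A : Ty} → Tm Γ A → Tm Γ A → Set (o ⊔ ℓ)
  data _≈βηs_ {Γ : Ctx} : {G : Ctx} → Sub Γ G → Sub Γ G → Set (o ⊔ ℓ)
  data _≈βη_ {Γ} where
    βη-refl  : {M : Tm Γ A} → M ≈βη M
    βη-sym   : {M N : Tm Γ A} → M ≈βη N → N ≈βη M
    βη-trans : {M N K : Tm Γ A} → M ≈βη N → N ≈βη K → M ≈βη K
    pair-cong : {M M' : Tm Γ A} {N N' : Tm Γ B} → M ≈βη M' → N ≈βη N' → pair M N ≈βη pair M' N'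
    fst-cong  : {M M' : Tm Γ (A ⊗ B)} → M ≈βη M' → fst M ≈βη fst M'
    snd-cong  : {M M' : Tm Γ (A ⊗ B)} → M ≈βη M' → snd M ≈βη snd M'
    lam-cong  : {M M' : Tm (Γ ▸ A) B} → M ≈βη M' → lam M ≈βη lam M'
    app-cong  : {M M' : Tm Γ (A ⇒ B)} {N N' : Tm Γ A} → M ≈βη M' → N ≈βη N' → app M N ≈βη app M' N'
    op-cong   : {f : Hom (h₀c G) (h₀ A)} {σ τ : Sub Γ G} → σ ≈βηs τ → op {A = A} f σ ≈βη op f τ
    β⇒  : {M : Tm (Γ ▸ A) B} {N : Tm Γ A} → app (lam M) N ≈βη sub (idS , N) M
    β⊗₁ : {M : Tm Γ A} {N : Tm Γ B} → fst (pair M N) ≈βη M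
    β⊗₂ : {M : Tm Γ A} {N : Tm Γ B} → snd (pair M N) ≈βη N
    η⇒  : {M : Tm Γ (A ⇒ B)} → M ≈βη lam (app (ren wk M) (var zero))
    η⊗  : {M : Tm Γ (A ⊗ B)} → M ≈βη pair (fst M) (snd M)
    η𝟙  : {M : Tm Γ 𝟙} → M ≈βη unit
  data _≈βηs_ {Γ} where
    []  : [] ≈βηs []
    _,_ : {σ τ : Sub Γ G} {M N : Tm Γ A} → σ ≈βηs τ → M ≈βη N → (σ , M) ≈βηs (τ , N)

  h₁v : Γ ∋ A → Hom (h₀c Γ) (h₀ A)
  h₁v zero    = π₂
  h₁v (suc x) = h₁v x ∘ π₁

  h₁  : Tm Γ A → Hom (h₀c Γ) (h₀ A)
  h₁s : Sub Γ G → Hom (h₀c Γ) (h₀c G)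
  h₁ (var x)    = h₁v x
  h₁ unit       = !
  h₁ (pair M N) = ⟨ h₁ M , h₁ N ⟩
  h₁ (fst M)    = π₁ ∘ h₁ M
  h₁ (snd M)    = π₂ ∘ h₁ M
  h₁ (lam M)    = cur (h₁ M)
  h₁ (app M N)  = ev ∘ ⟨ h₁ M , h₁ N ⟩
  h₁ (op f σ)   = f ∘ h₁s σ
  h₁s []      = !
  h₁s (σ , M) = ⟨ h₁s σ , h₁ M ⟩

  _∘R_ : Ren Γ Δ → Ren Δ Θ → Ren Γ Θ
  ρ ∘R []       = []
  ρ ∘R (ρ' , x) = (ρ ∘R ρ') , lookupR ρ x

  _∘SR_ : Sub Γ Δ → Ren Δ Θ → Sub Γ Θ
  σ ∘SR []       = []
  σ ∘SR (ρ , x) = (σ ∘SR ρ) , lookup σ x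

  ren-ext : {ρ ρ' : Ren Γ Δ} → (∀ {A} (x : Δ ∋ A) → lookupR ρ x ≡ lookupR ρ' x) → ρ ≡ ρ'
  ren-ext {ρ = []}    {[]}      h = refl
  ren-ext {ρ = ρ , x} {ρ' , x'} h = cong₂ _,_ (ren-ext (λ y → h (suc y))) (h zero)

  sub-ext : {σ σ' : Sub Γ Δ} → (∀ {A} (x : Δ ∋ A) → lookup σ x ≡ lookup σ' x) → σ ≡ σ'
  sub-ext {σ = []}    {[]}      h = refl
  sub-ext {σ = σ , x} {σ' , x'} h = cong₂ _,_ (sub-ext (λ y → h (suc y))) (h zero)

  lookupR-wkR : (ρ : Ren Γ Δ) (x : Δ ∋ A) → lookupR (wkR {B = B} ρ) x ≡ suc (lookupR ρ x)
  lookupR-wkR (ρ , y) zero    = refl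
  lookupR-wkR (ρ , y) (suc x) = lookupR-wkR ρ x

  lookupR-idR : (x : Γ ∋ A) → lookupR idR x ≡ x
  lookupR-idR zero    = refl
  lookupR-idR (suc x) = trans (lookupR-wkR idR x) (cong suc (lookupR-idR x))

  lookupR-wk : (x : Γ ∋ A) → lookupR (wk {A = B}) x ≡ suc x
  lookupR-wk x = trans (lookupR-wkR idR x) (cong suc (lookupR-idR x))

  lookupR-∘ : (ρ : Ren Γ Δ) (ρ' : Ren Δ Θ) (x : Θ ∋ A) → lookupR (ρ ∘R ρ') x ≡ lookupR ρ (lookupR ρ' x)
  lookupR-∘ ρ (ρ' , y) zero    = refl
  lookupR-∘ ρ (ρ' , y) (suc x) = lookupR-∘ ρ ρ' x

  lookup-∘SR : (σ : Sub Γ Δ) (ρ : Ren Δ Θ) (x : Θ ∋ A) → lookup (σ ∘SR ρ) x ≡ lookup σ (lookupR ρ x)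
  lookup-∘SR σ (ρ , y) zero    = refl
  lookup-∘SR σ (ρ , y) (suc x) = lookup-∘SR σ ρ x

  lookup-rens : (ρ : Ren Γ Δ) (σ : Sub Δ G) (x : G ∋ A) → lookup (rens ρ σ) x ≡ ren ρ (lookup σ x)
  lookup-rens ρ (σ , M) zero    = refl
  lookup-rens ρ (σ , M) (suc x) = lookup-rens ρ σ x

  lookup-subs : (σ : Sub Γ Δ) (τ : Sub Δ G) (x : G ∋ A) → lookup (subs σ τ) x ≡ sub σ (lookup τ x)
  lookup-subs σ (τ , M) zero    = refl
  lookup-subs σ (τ , M) (suc x) = lookup-subs σ τ x

  lookup-idS : (x : Γ ∋ A) → lookup idS x ≡ var x
  lookup-idS zero    = refl
  lookup-idS (suc x) = trans (lookup-rens wk idS x)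
                        (trans (cong (ren wk) (lookup-idS x)) (cong var (lookupR-wk x)))

  liftR-∘ : (ρ : Ren Γ Δ) (ρ' : Ren Δ Θ) → liftR {A = A} ρ ∘R liftR ρ' ≡ liftR (ρ ∘R ρ')
  liftR-∘ ρ ρ' = ren-ext λ
    { zero    → refl
    ; (suc y) → trans (lookupR-∘ (liftR ρ) (liftR ρ') (suc y))
                (trans (cong (lookupR (liftR ρ)) (lookupR-wkR ρ' y))
                (trans (lookupR-wkR ρ (lookupR ρ' y))
                (sym (trans (lookupR-wkR (ρ ∘R ρ') y) (cong suc (lookupR-∘ ρ ρ' y)))))) }

  lift-wk : (ρ : Ren Γ Δ) → liftR {A = A} ρ ∘R wk ≡ wk ∘R ρ
  lift-wk ρ = ren-ext λ x →
    trans (lookupR-∘ (liftR ρ) wk x)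
    (trans (cong (lookupR (liftR ρ)) (lookupR-wk x))
    (trans (lookupR-wkR ρ x)
    (sym (trans (lookupR-∘ wk ρ x) (lookupR-wk (lookupR ρ x))))))

  ren-ren  : (ρ : Ren Γ Δ) (ρ' : Ren Δ Θ) (M : Tm Θ A) → ren ρ (ren ρ' M) ≡ ren (ρ ∘R ρ') M
  rens-rens : (ρ : Ren Γ Δ) (ρ' : Ren Δ Θ) (σ : Sub Θ G) → rens ρ (rens ρ' σ) ≡ rens (ρ ∘R ρ') σ
  ren-ren ρ ρ' (var x)    = cong var (sym (lookupR-∘ ρ ρ' x))
  ren-ren ρ ρ' unit       = refl
  ren-ren ρ ρ' (pair M N) = cong₂ pair (ren-ren ρ ρ' M) (ren-ren ρ ρ' N)
  ren-ren ρ ρ' (fst M)    = cong fst (ren-ren ρ ρ' M)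
  ren-ren ρ ρ' (snd M)    = cong snd (ren-ren ρ ρ' M)
  ren-ren ρ ρ' (lam M)    = cong lam (trans (ren-ren (liftR ρ) (liftR ρ') M)
                                            (cong (λ r → ren r M) (liftR-∘ ρ ρ')))
  ren-ren ρ ρ' (app M N)  = cong₂ app (ren-ren ρ ρ' M) (ren-ren ρ ρ' N)
  ren-ren ρ ρ' (op f σ)   = cong (op f) (rens-rens ρ ρ' σ)
  rens-rens ρ ρ' []      = refl
  rens-rens ρ ρ' (σ , M) = cong₂ _,_ (rens-rens ρ ρ' σ) (ren-ren ρ ρ' M)

  ren-wk-comm : (ρ : Ren Γ Δ) (M : Tm Δ B) → ren (liftR {A = A} ρ) (ren wk M) ≡ ren wk (ren ρ M)
  ren-wk-comm ρ M = trans (ren-ren (liftR ρ) wk M)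
                   (trans (cong (λ r → ren r M) (lift-wk ρ)) (sym (ren-ren wk ρ M)))

  rens-liftS : (ρ : Ren Γ Δ) (σ : Sub Δ G) → rens (liftR {A = A} ρ) (liftS σ) ≡ liftS (rens ρ σ)
  rens-liftS ρ σ = sub-ext λ
    { zero    → refl
    ; (suc y) → trans (lookup-rens (liftR ρ) (rens wk σ) y)
                (trans (cong (ren (liftR ρ)) (lookup-rens wk σ y))
                (trans (ren-wk-comm ρ (lookup σ y))
                (sym (trans (lookup-rens wk (rens ρ σ) y) (cong (ren wk) (lookup-rens ρ σ y)))))) }

  ren-sub  : (ρ : Ren Γ Δ) (σ : Sub Δ Θ) (M : Tm Θ A) → ren ρ (sub σ M) ≡ sub (rens ρ σ) M
  rens-subs : (ρ : Ren Γ Δ) (σ : Sub Δ Θ) (τ : Sub Θ G) → rens ρ (subs σ τ) ≡ subs (rens ρ σ) τ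
  ren-sub ρ σ (var x)    = sym (lookup-rens ρ σ x)
  ren-sub ρ σ unit       = refl
  ren-sub ρ σ (pair M N) = cong₂ pair (ren-sub ρ σ M) (ren-sub ρ σ N)
  ren-sub ρ σ (fst M)    = cong fst (ren-sub ρ σ M)
  ren-sub ρ σ (snd M)    = cong snd (ren-sub ρ σ M)
  ren-sub ρ σ (lam M)    = cong lam (trans (ren-sub (liftR ρ) (liftS σ) M)
                                           (cong (λ s → sub s M) (rens-liftS ρ σ)))
  ren-sub ρ σ (app M N)  = cong₂ app (ren-sub ρ σ M) (ren-sub ρ σ N)
  ren-sub ρ σ (op f τ)   = cong (op f) (rens-subs ρ σ τ)
  rens-subs ρ σ []      = refl
  rens-subs ρ σ (τ , M) = cong₂ _,_ (rens-subs ρ σ τ) (ren-sub ρ σ M)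

  liftS-∘SR : (σ : Sub Γ Δ) (ρ : Ren Δ Θ) → liftS {A = A} σ ∘SR liftR ρ ≡ liftS (σ ∘SR ρ)
  liftS-∘SR σ ρ = sub-ext λ
    { zero    → refl
    ; (suc y) → trans (lookup-∘SR (liftS σ) (liftR ρ) (suc y))
                (trans (cong (lookup (liftS σ)) (lookupR-wkR ρ y))
                (trans (lookup-rens wk σ (lookupR ρ y))
                (sym (trans (lookup-rens wk (σ ∘SR ρ) y) (cong (ren wk) (lookup-∘SR σ ρ y)))))) }

  sub-ren  : (σ : Sub Γ Δ) (ρ : Ren Δ Θ) (M : Tm Θ A) → sub σ (ren ρ M) ≡ sub (σ ∘SR ρ) M
  subs-rens : (σ : Sub Γ Δ) (ρ : Ren Δ Θ) (τ : Sub Θ G) → subs σ (rens ρ τ) ≡ subs (σ ∘SR ρ) τ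
  sub-ren σ ρ (var x)    = sym (lookup-∘SR σ ρ x)
  sub-ren σ ρ unit       = refl
  sub-ren σ ρ (pair M N) = cong₂ pair (sub-ren σ ρ M) (sub-ren σ ρ N)
  sub-ren σ ρ (fst M)    = cong fst (sub-ren σ ρ M)
  sub-ren σ ρ (snd M)    = cong snd (sub-ren σ ρ M)
  sub-ren σ ρ (lam M)    = cong lam (trans (sub-ren (liftS σ) (liftR ρ) M)
                                           (cong (λ s → sub s M) (liftS-∘SR σ ρ)))
  sub-ren σ ρ (app M N)  = cong₂ app (sub-ren σ ρ M) (sub-ren σ ρ N)
  sub-ren σ ρ (op f τ)   = cong (op f) (subs-rens σ ρ τ)
  subs-rens σ ρ []      = refl
  subs-rens σ ρ (τ , M) = cong₂ _,_ (subs-rens σ ρ τ) (sub-ren σ ρ M)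

  cons-∘SR-wk : (σ : Sub Γ Δ) (N : Tm Γ A) → (σ , N) ∘SR wk ≡ σ
  cons-∘SR-wk σ N = sub-ext λ x → trans (lookup-∘SR (σ , N) wk x) (cong (lookup (σ , N)) (lookupR-wk x))

  liftS-∘SR-wk : (σ : Sub Γ Δ) → liftS {A = A} σ ∘SR wk ≡ rens wk σ
  liftS-∘SR-wk σ = cons-∘SR-wk (rens wk σ) (var zero)

  sub-wk-comm : (σ : Sub Γ Δ) (M : Tm Δ B) → sub (liftS {A = A} σ) (ren wk M) ≡ ren wk (sub σ M)
  sub-wk-comm σ M = trans (sub-ren (liftS σ) wk M)
                   (trans (cong (λ s → sub s M) (liftS-∘SR-wk σ)) (sym (ren-sub wk σ M)))

  subs-liftS : (σ : Sub Γ Δ) (τ : Sub Δ G) → subs (liftS {A = A} σ) (liftS τ) ≡ liftS (subs σ τ)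
  subs-liftS σ τ = sub-ext λ
    { zero    → refl
    ; (suc y) → trans (lookup-subs (liftS σ) (rens wk τ) y)
                (trans (cong (sub (liftS σ)) (lookup-rens wk τ y))
                (trans (sub-wk-comm σ (lookup τ y))
                (sym (trans (lookup-rens wk (subs σ τ) y) (cong (ren wk) (lookup-subs σ τ y)))))) }

  sub-sub  : (σ : Sub Γ Δ) (τ : Sub Δ Θ) (M : Tm Θ A) → sub σ (sub τ M) ≡ sub (subs σ τ) M
  subs-subs : (σ : Sub Γ Δ) (τ : Sub Δ Θ) (υ : Sub Θ G) → subs σ (subs τ υ) ≡ subs (subs σ τ) υ
  sub-sub σ τ (var x)    = sym (lookup-subs σ τ x)
  sub-sub σ τ unit       = refl
  sub-sub σ τ (pair M N) = cong₂ pair (sub-sub σ τ M) (sub-sub σ τ N)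
  sub-sub σ τ (fst M)    = cong fst (sub-sub σ τ M)
  sub-sub σ τ (snd M)    = cong snd (sub-sub σ τ M)
  sub-sub σ τ (lam M)    = cong lam (trans (sub-sub (liftS σ) (liftS τ) M)
                                           (cong (λ s → sub s M) (subs-liftS σ τ)))
  sub-sub σ τ (app M N)  = cong₂ app (sub-sub σ τ M) (sub-sub σ τ N)
  sub-sub σ τ (op f υ)   = cong (op f) (subs-subs σ τ υ)
  subs-subs σ τ []      = refl
  subs-subs σ τ (υ , M) = cong₂ _,_ (subs-subs σ τ υ) (sub-sub σ τ M)

  sub-idS  : (M : Tm Γ A) → sub idS M ≡ M
  subs-idS : (σ : Sub Γ G) → subs idS σ ≡ σ
  sub-idS (var x)    = lookup-idS x
  sub-idS unit       = refl
  sub-idS (pair M N) = cong₂ pair (sub-idS M) (sub-idS N)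
  sub-idS (fst M)    = cong fst (sub-idS M)
  sub-idS (snd M)    = cong snd (sub-idS M)
  sub-idS (lam M)    = cong lam (sub-idS M)
  sub-idS (app M N)  = cong₂ app (sub-idS M) (sub-idS N)
  sub-idS (op f σ)   = cong (op f) (subs-idS σ)
  subs-idS []      = refl
  subs-idS (σ , M) = cong₂ _,_ (subs-idS σ) (sub-idS M)

  ≡→βη : {M N : Tm Γ A} → M ≡ N → M ≈βη N
  ≡→βη refl = βη-refl

  ren-β : (ρ : Ren Γ Δ) (M : Tm (Δ ▸ A) B) (N : Tm Δ A) →
          sub (idS , ren ρ N) (ren (liftR ρ) M) ≡ ren ρ (sub (idS , N) M)
  ren-β ρ M N = trans (sub-ren (idS , ren ρ N) (liftR ρ) M)
               (trans (cong (λ s → sub s M) (sub-ext λ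
                  { zero    → refl
                  ; (suc y) → trans (lookup-∘SR (idS , ren ρ N) (liftR ρ) (suc y))
                              (trans (cong (lookup (idS , ren ρ N)) (lookupR-wkR ρ y))
                              (trans (lookup-idS (lookupR ρ y))
                              (sym (trans (lookup-rens ρ idS y) (cong (ren ρ) (lookup-idS y)))))) }))
               (sym (ren-sub ρ (idS , N) M)))

  ren-≈  : (ρ : Ren Γ Δ) {M N : Tm Δ A} → M ≈βη N → ren ρ M ≈βη ren ρ N
  rens-≈ : (ρ : Ren Γ Δ) {σ τ : Sub Δ G} → σ ≈βηs τ → rens ρ σ ≈βηs rens ρ τ
  ren-≈ ρ βη-refl          = βη-refl
  ren-≈ ρ (βη-sym e)       = βη-sym (ren-≈ ρ e)
  ren-≈ ρ (βη-trans e e')  = βη-trans (ren-≈ ρ e) (ren-≈ ρ e')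
  ren-≈ ρ (pair-cong e e') = pair-cong (ren-≈ ρ e) (ren-≈ ρ e')
  ren-≈ ρ (fst-cong e)     = fst-cong (ren-≈ ρ e)
  ren-≈ ρ (snd-cong e)     = snd-cong (ren-≈ ρ e)
  ren-≈ ρ (lam-cong e)     = lam-cong (ren-≈ (liftR ρ) e)
  ren-≈ ρ (app-cong e e')  = app-cong (ren-≈ ρ e) (ren-≈ ρ e')
  ren-≈ ρ (op-cong e)      = op-cong (rens-≈ ρ e)
  ren-≈ ρ (β⇒ {M = M} {N}) = βη-trans β⇒ (≡→βη (ren-β ρ M N))
  ren-≈ ρ β⊗₁              = β⊗₁
  ren-≈ ρ β⊗₂              = β⊗₂
  ren-≈ ρ (η⇒ {M = M})     = βη-trans η⇒ (≡→βη (cong (λ z → lam (app z (var zero))) (sym (ren-wk-comm ρ M))))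
  ren-≈ ρ η⊗               = η⊗
  ren-≈ ρ η𝟙               = η𝟙
  rens-≈ ρ []       = []
  rens-≈ ρ (e , e') = rens-≈ ρ e , ren-≈ ρ e'

  sub-β : (σ : Sub Γ Δ) (M : Tm (Δ ▸ A) B) (N : Tm Δ A) →
          sub (idS , sub σ N) (sub (liftS σ) M) ≡ sub σ (sub (idS , N) M)
  sub-β σ M N = trans (sub-sub (idS , sub σ N) (liftS σ) M)
               (trans (cong (λ s → sub s M) (sub-ext λ
                  { zero    → refl
                  ; (suc y) → trans (lookup-subs (idS , sub σ N) (rens wk σ) y)
                              (trans (cong (sub (idS , sub σ N)) (lookup-rens wk σ y))
                              (trans (sub-ren (idS , sub σ N) wk (lookup σ y))
                              (trans (cong (λ s → sub s (lookup σ y)) (cons-∘SR-wk idS (sub σ N)))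
                              (trans (sub-idS (lookup σ y))
                              (sym (trans (lookup-subs σ idS y) (cong (sub σ) (lookup-idS y)))))))) }))
               (sym (sub-sub σ (idS , N) M)))

  sub-≈  : (σ : Sub Γ Δ) {M N : Tm Δ A} → M ≈βη N → sub σ M ≈βη sub σ N
  subs-≈ : (σ : Sub Γ Δ) {τ τ' : Sub Δ G} → τ ≈βηs τ' → subs σ τ ≈βηs subs σ τ'
  sub-≈ σ βη-refl          = βη-refl
  sub-≈ σ (βη-sym e)       = βη-sym (sub-≈ σ e)
  sub-≈ σ (βη-trans e e')  = βη-trans (sub-≈ σ e) (sub-≈ σ e')
  sub-≈ σ (pair-cong e e') = pair-cong (sub-≈ σ e) (sub-≈ σ e')
  sub-≈ σ (fst-cong e)     = fst-cong (sub-≈ σ e)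
  sub-≈ σ (snd-cong e)     = snd-cong (sub-≈ σ e)
  sub-≈ σ (lam-cong e)     = lam-cong (sub-≈ (liftS σ) e)
  sub-≈ σ (app-cong e e')  = app-cong (sub-≈ σ e) (sub-≈ σ e')
  sub-≈ σ (op-cong e)      = op-cong (subs-≈ σ e)
  sub-≈ σ (β⇒ {M = M} {N}) = βη-trans β⇒ (≡→βη (sub-β σ M N))
  sub-≈ σ β⊗₁              = β⊗₁
  sub-≈ σ β⊗₂              = β⊗₂
  sub-≈ σ (η⇒ {M = M})     = βη-trans η⇒ (≡→βη (cong (λ z → lam (app z (var zero))) (sym (sub-wk-comm σ M))))
  sub-≈ σ η⊗               = η⊗
  sub-≈ σ η𝟙               = η𝟙
  subs-≈ σ []       = []
  subs-≈ σ (e , e') = subs-≈ σ e , sub-≈ σ e'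

  private
    pair-nat : ∀ {D E A' B'} {f : Hom E A'} {g : Hom E B'} {h : Hom D E} →
               ⟨ f , g ⟩ ∘ h ≡ ⟨ f ∘ h , g ∘ h ⟩
    pair-nat = trans (sym ×-η) (cong₂ ⟨_,_⟩ (trans (sym assoc) (cong (_∘ _) ×-β₁))
                                           (trans (sym assoc) (cong (_∘ _) ×-β₂)))

    pair-id : ∀ {A' B'} → ⟨ π₁ {A'} {B'} , π₂ ⟩ ≡ id
    pair-id = trans (cong₂ ⟨_,_⟩ (sym identʳ) (sym identʳ)) ×-η

    cur-nat : ∀ {D E A' B'} {f : Hom (E × A') B'} {g : Hom D E} →
              cur f ∘ g ≡ cur (f ∘ ⟨ g ∘ π₁ , π₂ ⟩)
    cur-nat {f = f} {g} = trans (sym cur-η) (cong cur (trans (cong (ev ∘_) (cong₂ ⟨_,_⟩ assoc refl))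
                          (sym (trans (cong (_∘ _) (sym cur-β))
                          (trans assoc (cong (ev ∘_) (trans pair-nat (cong₂ ⟨_,_⟩
                             (trans assoc (cong (cur f ∘_) ×-β₁)) ×-β₂))))))))

    step-pair : ∀ {D E A' B'} {f : Hom E A'} {g : Hom E B'} {h : Hom D E} {f₀ : Hom D A'} {g₀ : Hom D B'} →
                f₀ ≡ f ∘ h → g₀ ≡ g ∘ h → ⟨ f₀ , g₀ ⟩ ≡ ⟨ f , g ⟩ ∘ h
    step-pair p q = trans (cong₂ ⟨_,_⟩ p q) (sym pair-nat)

    step-post : ∀ {D E A' B'} {k : Hom A' B'} {f : Hom E A'} {h : Hom D E} {f₀ : Hom D A'} →
                f₀ ≡ f ∘ h → k ∘ f₀ ≡ (k ∘ f) ∘ h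
    step-post p = trans (cong (_ ∘_) p) (sym assoc)

  h₁R : Ren Γ Δ → Hom (h₀c Γ) (h₀c Δ)
  h₁R []      = !
  h₁R (ρ , x) = ⟨ h₁R ρ , h₁v x ⟩

  h₁v-lookupR : (ρ : Ren Γ Δ) (x : Δ ∋ A) → h₁v (lookupR ρ x) ≡ h₁v x ∘ h₁R ρ
  h₁v-lookupR (ρ , y) zero    = sym ×-β₂
  h₁v-lookupR (ρ , y) (suc x) = trans (h₁v-lookupR ρ x)
                                 (trans (cong (h₁v x ∘_) (sym ×-β₁)) (sym assoc))

  h₁R-wkR : (ρ : Ren Γ Δ) → h₁R (wkR {B = B} ρ) ≡ h₁R ρ ∘ π₁
  h₁R-wkR []      = sym (!-η _)
  h₁R-wkR {B = B} (ρ , x) = step-pair (h₁R-wkR {B = B} ρ) refl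

  h₁R-idR : h₁R (idR {Γ}) ≡ id
  h₁R-idR {ε}     = sym (!-η _)
  h₁R-idR {Γ ▸ A} = trans (cong₂ ⟨_,_⟩ (trans (h₁R-wkR {B = A} (idR {Γ})) (trans (cong (_∘ π₁) (h₁R-idR {Γ})) identˡ)) refl) pair-id

  h₁R-wk : h₁R (wk {Γ} {A}) ≡ π₁
  h₁R-wk {Γ} {A} = trans (h₁R-wkR {B = A} (idR {Γ})) (trans (cong (_∘ π₁) (h₁R-idR {Γ})) identˡ)

  h₁-ren  : (ρ : Ren Γ Δ) (M : Tm Δ A) → h₁ (ren ρ M) ≡ h₁ M ∘ h₁R ρ
  h₁s-rens : (ρ : Ren Γ Δ) (σ : Sub Δ G) → h₁s (rens ρ σ) ≡ h₁s σ ∘ h₁R ρ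
  h₁-ren ρ (var x)    = h₁v-lookupR ρ x
  h₁-ren ρ unit       = sym (!-η _)
  h₁-ren ρ (pair M N) = step-pair (h₁-ren ρ M) (h₁-ren ρ N)
  h₁-ren ρ (fst M)    = step-post (h₁-ren ρ M)
  h₁-ren ρ (snd M)    = step-post (h₁-ren ρ M)
  h₁-ren ρ (lam M)    = trans (cong cur (trans (h₁-ren (liftR ρ) M)
                                 (cong (h₁ M ∘_) (cong₂ ⟨_,_⟩ (h₁R-wkR ρ) refl)))) (sym cur-nat)
  h₁-ren ρ (app M N)  = step-post (step-pair (h₁-ren ρ M) (h₁-ren ρ N))
  h₁-ren ρ (op f σ)   = step-post (h₁s-rens ρ σ)
  h₁s-rens ρ []      = sym (!-η _)
  h₁s-rens ρ (σ , M) = step-pair (h₁s-rens ρ σ) (h₁-ren ρ M)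

  h₁s-wk : (σ : Sub Γ G) → h₁s (rens (wk {A = A}) σ) ≡ h₁s σ ∘ π₁
  h₁s-wk {Γ} {A = A} σ = trans (h₁s-rens wk σ) (cong (h₁s σ ∘_) (h₁R-wk {Γ} {A}))

  h₁-wk : (M : Tm Γ B) → h₁ (ren (wk {A = A}) M) ≡ h₁ M ∘ π₁
  h₁-wk {Γ} {A = A} M = trans (h₁-ren wk M) (cong (h₁ M ∘_) (h₁R-wk {Γ} {A}))

  h₁-lookup : (σ : Sub Γ G) (x : G ∋ A) → h₁ (lookup σ x) ≡ h₁v x ∘ h₁s σ
  h₁-lookup (σ , M) zero    = sym ×-β₂
  h₁-lookup (σ , M) (suc x) = trans (h₁-lookup σ x)
                               (trans (cong (h₁v x ∘_) (sym ×-β₁)) (sym assoc))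

  h₁-sub  : (σ : Sub Γ Δ) (M : Tm Δ A) → h₁ (sub σ M) ≡ h₁ M ∘ h₁s σ
  h₁s-subs : (σ : Sub Γ Δ) (τ : Sub Δ G) → h₁s (subs σ τ) ≡ h₁s τ ∘ h₁s σ
  h₁-sub σ (var x)    = h₁-lookup σ x
  h₁-sub σ unit       = sym (!-η _)
  h₁-sub σ (pair M N) = step-pair (h₁-sub σ M) (h₁-sub σ N)
  h₁-sub σ (fst M)    = step-post (h₁-sub σ M)
  h₁-sub σ (snd M)    = step-post (h₁-sub σ M)
  h₁-sub σ (lam M)    = trans (cong cur (trans (h₁-sub (liftS σ) M)
                                 (cong (h₁ M ∘_) (cong₂ ⟨_,_⟩ (h₁s-wk σ) refl)))) (sym cur-nat)
  h₁-sub σ (app M N)  = step-post (step-pair (h₁-sub σ M) (h₁-sub σ N))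
  h₁-sub σ (op f τ)   = step-post (h₁s-subs σ τ)
  h₁s-subs σ []      = sym (!-η _)
  h₁s-subs σ (τ , M) = step-pair (h₁s-subs σ τ) (h₁-sub σ M)

  h₁s-idS : h₁s (idS {Γ}) ≡ id
  h₁s-idS {ε}     = sym (!-η _)
  h₁s-idS {Γ ▸ A} = trans (cong₂ ⟨_,_⟩ (trans (h₁s-wk {A = A} (idS {Γ})) (trans (cong (_∘ π₁) (h₁s-idS {Γ})) identˡ)) refl) pair-id

  sound  : {M N : Tm Γ A} → M ≈βη N → h₁ M ≡ h₁ N
  sounds : {σ τ : Sub Γ G} → σ ≈βηs τ → h₁s σ ≡ h₁s τ
  sound βη-refl          = refl
  sound (βη-sym e)       = sym (sound e)
  sound (βη-trans e e')  = trans (sound e) (sound e')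
  sound (pair-cong e e') = cong₂ ⟨_,_⟩ (sound e) (sound e')
  sound (fst-cong e)     = cong (π₁ ∘_) (sound e)
  sound (snd-cong e)     = cong (π₂ ∘_) (sound e)
  sound (lam-cong e)     = cong cur (sound e)
  sound (app-cong e e')  = cong (ev ∘_) (cong₂ ⟨_,_⟩ (sound e) (sound e'))
  sound (op-cong e)      = cong (_ ∘_) (sounds e)
  sound {Γ} (β⇒ {M = M} {N}) = sym (trans (h₁-sub (idS , N) M)
      (trans (cong (λ z → h₁ M ∘ ⟨ z , h₁ N ⟩) (h₁s-idS {Γ}))
      (trans (cong (_∘ ⟨ id , h₁ N ⟩) (sym (cur-β {f = h₁ M})))
      (trans assoc (cong (ev ∘_) (trans pair-nat (cong₂ ⟨_,_⟩
           (trans assoc (trans (cong (cur (h₁ M) ∘_) ×-β₁) identʳ)) ×-β₂)))))))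
  sound β⊗₁              = ×-β₁
  sound β⊗₂              = ×-β₂
  sound (η⇒ {M = M})     = sym (trans (cong (λ z → cur (ev ∘ ⟨ z , π₂ ⟩)) (h₁-wk M)) cur-η)
  sound η⊗               = sym ×-η
  sound η𝟙               = !-η _
  sounds []       = refl
  sounds (e , e') = cong₂ ⟨_,_⟩ (sounds e) (sound e')

  -- Terms are taken modulo βη: vertical composition P ;_{N} Q is allowed
  -- whenever the target of P and the source of Q are βη-equal (the
  -- βη-proof is recorded but is irrelevant for permutation equivalence).
  -- A rule r over (G ⊢ M,N : A) of V(C) is a 2-cell α : h₁ M ⇒ h₁ N.

  infixl 4 _⨾[_]_
  data Red  (Γ : Ctx) : (A : Ty) → Tm Γ A → Tm Γ A → Set (o ⊔ ℓ ⊔ c)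
  data Reds (Γ : Ctx) : (G : Ctx) → Sub Γ G → Sub Γ G → Set (o ⊔ ℓ ⊔ c)
  data Red Γ where
    var    : (x : Γ ∋ A) → Red Γ A (var x) (var x)
    unit   : Red Γ 𝟙 unit unit
    op     : ∀ {G A σ τ} (f : Hom (h₀c G) (h₀ A)) → Reds Γ G σ τ → Red Γ A (op f σ) (op f τ)
    rule   : ∀ {G A σ τ} (M N : Tm G A) (α : Cell (h₁ M) (h₁ N)) →
             Reds Γ G σ τ → Red Γ A (sub σ M) (sub τ N)
    _⨾[_]_ : ∀ {M N N' K} → Red Γ A M N → N ≈βη N' → Red Γ A N' K → Red Γ A M K
    lam    : ∀ {M N} → Red (Γ ▸ A) B M N → Red Γ (A ⇒ B) (lam M) (lam N)
    app    : ∀ {M N M' N'} → Red Γ (A ⇒ B) M N → Red Γ A M' N' → Red Γ B (app M M') (app N N')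
    pair   : ∀ {M N M' N'} → Red Γ A M N → Red Γ B M' N' → Red Γ (A ⊗ B) (pair M M') (pair N N')
    fst    : ∀ {M N} → Red Γ (A ⊗ B) M N → Red Γ A (fst M) (fst N)
    snd    : ∀ {M N} → Red Γ (A ⊗ B) M N → Red Γ B (snd M) (snd N)
  data Reds Γ where
    []  : Reds Γ ε [] []
    _,_ : ∀ {σ τ M N} → Reds Γ G σ τ → Red Γ A M N → Reds Γ (G ▸ A) (σ , M) (τ , N)

  h₂  : ∀ {M N} → Red Γ A M N → Cell (h₁ M) (h₁ N)
  h₂s : ∀ {σ τ} → Reds Γ G σ τ → Cell (h₁s σ) (h₁s τ)
  h₂ (var x)      = id₂ (h₁v x)
  h₂ unit         = id₂ !
  h₂ (op f Ps)    = id₂ f ∗ h₂s Ps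
  h₂ (rule {σ = σ} {τ} M N α Ps) =
    subst₂ Cell (sym (h₁-sub σ M)) (sym (h₁-sub τ N)) (α ∗ h₂s Ps)
  h₂ (_⨾[_]_ {M = M} P e Q) = h₂ Q · subst (Cell (h₁ M)) (sound e) (h₂ P)
  h₂ (lam P)      = cur₂ (h₂ P)
  h₂ (app P Q)    = id₂ ev ∗ ⟨ h₂ P , h₂ Q ⟩₂
  h₂ (pair P Q)   = ⟨ h₂ P , h₂ Q ⟩₂
  h₂ (fst P)      = id₂ π₁ ∗ h₂ P
  h₂ (snd P)      = id₂ π₂ ∗ h₂ P
  h₂s []       = id₂ !
  h₂s (Ps , P) = ⟨ h₂s Ps , h₂ P ⟩₂

  tm  : (M : Tm Γ A) → Red Γ A M M
  tms : (σ : Sub Γ G) → Reds Γ G σ σ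
  tm (var x)    = var x
  tm unit       = unit
  tm (pair M N) = pair (tm M) (tm N)
  tm (fst M)    = fst (tm M)
  tm (snd M)    = snd (tm M)
  tm (lam M)    = lam (tm M)
  tm (app M N)  = app (tm M) (tm N)
  tm (op f σ)   = op f (tms σ)
  tms []      = []
  tms (σ , M) = tms σ , tm M

  renR  : ∀ {M N} (ρ : Ren Γ Δ) → Red Δ A M N → Red Γ A (ren ρ M) (ren ρ N)
  renRs : ∀ {σ τ} (ρ : Ren Γ Δ) → Reds Δ G σ τ → Reds Γ G (rens ρ σ) (rens ρ τ)
  renR ρ (var x)      = var (lookupR ρ x)
  renR ρ unit         = unit
  renR ρ (op f Ps)    = op f (renRs ρ Ps)
  renR ρ (rule {σ = σ} {τ} M N α Ps) =
    subst₂ (Red _ _) (sym (ren-sub ρ σ M)) (sym (ren-sub ρ τ N)) (rule M N α (renRs ρ Ps))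
  renR ρ (P ⨾[ e ] Q) = renR ρ P ⨾[ ren-≈ ρ e ] renR ρ Q
  renR ρ (lam P)      = lam (renR (liftR ρ) P)
  renR ρ (app P Q)    = app (renR ρ P) (renR ρ Q)
  renR ρ (pair P Q)   = pair (renR ρ P) (renR ρ Q)
  renR ρ (fst P)      = fst (renR ρ P)
  renR ρ (snd P)      = snd (renR ρ P)
  renRs ρ []       = []
  renRs ρ (Ps , P) = renRs ρ Ps , renR ρ P

  subR  : ∀ {M N} (σ : Sub Γ Δ) → Red Δ A M N → Red Γ A (sub σ M) (sub σ N)
  subRs : ∀ {τ τ'} (σ : Sub Γ Δ) → Reds Δ G τ τ' → Reds Γ G (subs σ τ) (subs σ τ')
  subR σ (var x)      = tm (lookup σ x)
  subR σ unit         = unit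
  subR σ (op f Ps)    = op f (subRs σ Ps)
  subR σ (rule {σ = τ} {τ'} M N α Ps) =
    subst₂ (Red _ _) (sym (sub-sub σ τ M)) (sym (sub-sub σ τ' N)) (rule M N α (subRs σ Ps))
  subR σ (P ⨾[ e ] Q) = subR σ P ⨾[ sub-≈ σ e ] subR σ Q
  subR σ (lam P)      = lam (subR (liftS σ) P)
  subR σ (app P Q)    = app (subR σ P) (subR σ Q)
  subR σ (pair P Q)   = pair (subR σ P) (subR σ Q)
  subR σ (fst P)      = fst (subR σ P)
  subR σ (snd P)      = snd (subR σ P)
  subRs σ []       = []
  subRs σ (Ps , P) = subRs σ Ps , subR σ P

  lookupRs : ∀ {σ τ} → Reds Γ Δ σ τ → (x : Δ ∋ A) → Red Γ A (lookup σ x) (lookup τ x)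
  lookupRs (Qs , Q) zero    = Q
  lookupRs (Qs , Q) (suc x) = lookupRs Qs x

  liftRs : ∀ {σ τ} → Reds Γ Δ σ τ → Reds (Γ ▸ A) (Δ ▸ A) (liftS σ) (liftS τ)
  liftRs Qs = renRs wk Qs , var zero

  tmR  : ∀ {σ τ} (M : Tm Δ A) → Reds Γ Δ σ τ → Red Γ A (sub σ M) (sub τ M)
  tmRs : ∀ {σ τ} (ν : Sub Δ G) → Reds Γ Δ σ τ → Reds Γ G (subs σ ν) (subs τ ν)
  tmR (var x)    Qs = lookupRs Qs x
  tmR unit       Qs = unit
  tmR (pair M N) Qs = pair (tmR M Qs) (tmR N Qs)
  tmR (fst M)    Qs = fst (tmR M Qs)
  tmR (snd M)    Qs = snd (tmR M Qs)
  tmR (lam M)    Qs = lam (tmR M (liftRs Qs))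
  tmR (app M N)  Qs = app (tmR M Qs) (tmR N Qs)
  tmR (op f ν)   Qs = op f (tmRs ν Qs)
  tmRs []      Qs = []
  tmRs (ν , M) Qs = tmRs ν Qs , tmR M Qs

  _[_] : ∀ {M M' σ τ} → Red Δ A M M' → Reds Γ Δ σ τ → Red Γ A (sub σ M) (sub τ M')
  _[_] {M' = M'} P Qs = subR _ P ⨾[ βη-refl ] tmR M' Qs

  _[_/0] : ∀ {M M' N N'} → Red (Γ ▸ A) B M M' → Red Γ A N N' →
           Red Γ B (sub (idS , N) M) (sub (idS , N') M')
  P [ Q /0] = P [ tms idS , Q ]

  _⨾s_ : ∀ {σ σ' τ} → Reds Γ G σ σ' → Reds Γ G σ' τ → Reds Γ G σ τ
  []       ⨾s []       = []
  (Ps , P) ⨾s (Qs , Q) = (Ps ⨾s Qs) , (P ⨾[ βη-refl ] Q)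

  infix 3 _≈_ _≈s_
  data _≈_  {Γ : Ctx} : ∀ {A M N M' N'} → Red Γ A M N → Red Γ A M' N' → Set (o ⊔ ℓ ⊔ c)
  data _≈s_ {Γ : Ctx} : ∀ {G σ τ σ' τ'} → Reds Γ G σ τ → Reds Γ G σ' τ' → Set (o ⊔ ℓ ⊔ c)
  data _≈_ {Γ} where
    ≈-refl  : ∀ {A M N} {P : Red Γ A M N} → P ≈ P
    ≈-sym   : ∀ {A M N M' N'} {P : Red Γ A M N} {Q : Red Γ A M' N'} → P ≈ Q → Q ≈ P
    ≈-trans : ∀ {A M N M' N' M'' N''} {P : Red Γ A M N} {Q : Red Γ A M' N'} {R : Red Γ A M'' N''} →
              P ≈ Q → Q ≈ R → P ≈ R
    op-≈   : ∀ {G A σ τ σ' τ'} (f : Hom (h₀c G) (h₀ A)) {Ps : Reds Γ G σ τ} {Qs : Reds Γ G σ' τ'} →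
             Ps ≈s Qs → op {A = A} f Ps ≈ op f Qs
    rule-≈ : ∀ {G A σ τ σ' τ'} {M N M' N' : Tm G A} {α : Cell (h₁ M) (h₁ N)} {α' : Cell (h₁ M') (h₁ N')}
             {Ps : Reds Γ G σ τ} {Qs : Reds Γ G σ' τ'} →
             M ≈βη M' → N ≈βη N' → α ≅ α' → Ps ≈s Qs → rule M N α Ps ≈ rule M' N' α' Qs
    ⨾-≈    : ∀ {A M N N₁ K M' N' N₁' K'} {P : Red Γ A M N} {Q : Red Γ A N₁ K}
             {P' : Red Γ A M' N'} {Q' : Red Γ A N₁' K'} {e : N ≈βη N₁} {e' : N' ≈βη N₁'} →
             P ≈ P' → Q ≈ Q' → (P ⨾[ e ] Q) ≈ (P' ⨾[ e' ] Q')
    lam-≈  : ∀ {M N M' N'} {P : Red (Γ ▸ A) B M N} {P' : Red (Γ ▸ A) B M' N'} →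
             P ≈ P' → lam P ≈ lam P'
    app-≈  : ∀ {M N M' N' K L K' L'} {P : Red Γ (A ⇒ B) M N} {P' : Red Γ (A ⇒ B) M' N'}
             {Q : Red Γ A K L} {Q' : Red Γ A K' L'} → P ≈ P' → Q ≈ Q' → app P Q ≈ app P' Q'
    pair-≈ : ∀ {M N M' N' K L K' L'} {P : Red Γ A M N} {P' : Red Γ A M' N'}
             {Q : Red Γ B K L} {Q' : Red Γ B K' L'} → P ≈ P' → Q ≈ Q' → pair P Q ≈ pair P' Q'
    fst-≈  : ∀ {M N M' N'} {P : Red Γ (A ⊗ B) M N} {P' : Red Γ (A ⊗ B) M' N'} → P ≈ P' → fst P ≈ fst P'
    snd-≈  : ∀ {M N M' N'} {P : Red Γ (A ⊗ B) M N} {P' : Red Γ (A ⊗ B) M' N'} → P ≈ P' → snd P ≈ snd P'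
    ⨾-assoc : ∀ {A M N N₁ K K₁ L} {P : Red Γ A M N} {Q : Red Γ A N₁ K} {R : Red Γ A K₁ L}
              {e : N ≈βη N₁} {e' : K ≈βη K₁} →
              ((P ⨾[ e ] Q) ⨾[ e' ] R) ≈ (P ⨾[ e ] (Q ⨾[ e' ] R))
    ⨾-idˡ   : ∀ {A M M' N} {P : Red Γ A M' N} {e : M ≈βη M'} → (tm M ⨾[ e ] P) ≈ P
    ⨾-idʳ   : ∀ {A M N N'} {P : Red Γ A M N} {e : N ≈βη N'} → (P ⨾[ e ] tm N') ≈ P
    β⇒  : ∀ {M M' N N'} {P : Red (Γ ▸ A) B M M'} {Q : Red Γ A N N'} → app (lam P) Q ≈ P [ Q /0]
    η⇒  : ∀ {M N} {P : Red Γ (A ⇒ B) M N} → P ≈ lam (app (renR wk P) (var zero))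
    β⊗₁ : ∀ {M N M' N'} {P : Red Γ A M N} {Q : Red Γ B M' N'} → fst (pair P Q) ≈ P
    β⊗₂ : ∀ {M N M' N'} {P : Red Γ A M N} {Q : Red Γ B M' N'} → snd (pair P Q) ≈ Q
    η⊗  : ∀ {M N} {P : Red Γ (A ⊗ B) M N} → P ≈ pair (fst P) (snd P)
    η𝟙  : ∀ {M N} {P : Red Γ 𝟙 M N} → P ≈ unit
    rule-⨾ˡ : ∀ {G A σ₁ σ₂ σ₃} {M₁ M₂ : Tm G A} {α : Cell (h₁ M₁) (h₁ M₂)}
              {Ps : Reds Γ G σ₁ σ₂} {Qs : Reds Γ G σ₂ σ₃} {e : sub σ₂ M₁ ≈βη sub σ₂ M₁} →
              rule M₁ M₂ α (Ps ⨾s Qs) ≈ (tmR M₁ Ps ⨾[ e ] rule M₁ M₂ α Qs)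
    rule-⨾ʳ : ∀ {G A σ₁ σ₂ σ₃} {M₁ M₂ : Tm G A} {α : Cell (h₁ M₁) (h₁ M₂)}
              {Ps : Reds Γ G σ₁ σ₂} {Qs : Reds Γ G σ₂ σ₃} {e : sub σ₂ M₂ ≈βη sub σ₂ M₂} →
              rule M₁ M₂ α (Ps ⨾s Qs) ≈ (rule M₁ M₂ α Ps ⨾[ e ] tmR M₂ Qs)
    op-⨾   : ∀ {G A σ₁ σ₂ σ₃} {f : Hom (h₀c G) (h₀ A)} {Ps : Reds Γ G σ₁ σ₂} {Qs : Reds Γ G σ₂ σ₃}
             {e : op {A = A} f σ₂ ≈βη op f σ₂} → op {A = A} f (Ps ⨾s Qs) ≈ (op f Ps ⨾[ e ] op f Qs)
    lam-⨾  : ∀ {M N N₁ K} {P : Red (Γ ▸ A) B M N} {Q : Red (Γ ▸ A) B N₁ K}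
             {e : N ≈βη N₁} {e' : lam N ≈βη lam N₁} → lam (P ⨾[ e ] Q) ≈ (lam P ⨾[ e' ] lam Q)
    app-⨾  : ∀ {M N N₁ K M' N' N₁' K'} {P : Red Γ (A ⇒ B) M N} {P' : Red Γ (A ⇒ B) N₁ K}
             {Q : Red Γ A M' N'} {Q' : Red Γ A N₁' K'} {e : N ≈βη N₁} {e' : N' ≈βη N₁'}
             {e'' : app N N' ≈βη app N₁ N₁'} →
             app (P ⨾[ e ] P') (Q ⨾[ e' ] Q') ≈ (app P Q ⨾[ e'' ] app P' Q')
    pair-⨾ : ∀ {M N N₁ K M' N' N₁' K'} {P : Red Γ A M N} {P' : Red Γ A N₁ K}
             {Q : Red Γ B M' N'} {Q' : Red Γ B N₁' K'} {e : N ≈βη N₁} {e' : N' ≈βη N₁'}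
             {e'' : pair N N' ≈βη pair N₁ N₁'} →
             pair (P ⨾[ e ] P') (Q ⨾[ e' ] Q') ≈ (pair P Q ⨾[ e'' ] pair P' Q')
    fst-⨾  : ∀ {M N N₁ K} {P : Red Γ (A ⊗ B) M N} {Q : Red Γ (A ⊗ B) N₁ K}
             {e : N ≈βη N₁} {e' : fst N ≈βη fst N₁} → fst (P ⨾[ e ] Q) ≈ (fst P ⨾[ e' ] fst Q)
    snd-⨾  : ∀ {M N N₁ K} {P : Red Γ (A ⊗ B) M N} {Q : Red Γ (A ⊗ B) N₁ K}
             {e : N ≈βη N₁} {e' : snd N ≈βη snd N₁} → snd (P ⨾[ e ] Q) ≈ (snd P ⨾[ e' ] snd Q)
  data _≈s_ {Γ} where
    []  : [] ≈s []
    _,_ : ∀ {G A σ τ σ' τ' M N M' N'} {Ps : Reds Γ G σ τ} {Qs : Reds Γ G σ' τ'}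
          {P : Red Γ A M N} {Q : Red Γ A M' N'} → Ps ≈s Qs → P ≈ Q → (Ps , P) ≈s (Qs , Q)

{-# OPTIONS --safe #-}
module Submission where

-- h₂ is defined by structural recursion on reductions, so it suffices to check
-- every generating equation of ≈ in 𝒞. The congruence equations and the
-- commutation of term constructors with ; hold because pairing, currying and
-- whiskering are functorial on hom-categories; the βη equations are the
-- two-dimensional universal properties of products and exponentials; the rule
-- equations are instances of the interchange law. The β-equation additionally
-- needs the two substitution lemmas: substituting terms σ into a reduction P
-- gives h₂ P whiskered by h₁ σ, and substituting reductions Qs into a term M
-- gives id(h₁ M) whiskered by h₂ Qs.

open import Level using (Level; _⊔_)
open import Relation.Binary.PropositionalEquality
  using (_≡_; refl; sym; trans; cong; cong₂; subst; subst₂; module ≡-Reasoning)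
open import Relation.Binary.HeterogeneousEquality using (_≅_; refl)
open import Defs

module CellCalculus {o ℓ c : Level} (𝒞 : CC2Cat o ℓ c) where
  open CC2Cat 𝒞
  open ≡-Reasoning

  -- A 2-cell packed with its boundary, so that 2-cells whose boundaries
  -- agree only propositionally can be compared with _≡_.
  data Cell⁺ (A B : Obj) : Set (ℓ ⊔ c) where
    ⌜_⌝ : {f g : Hom A B} → Cell f g → Cell⁺ A B

  infix 4 _≋_
  _≋_ : ∀ {A B} {f g f' g' : Hom A B} → Cell f g → Cell f' g' → Set (ℓ ⊔ c)
  α ≋ β = ⌜ α ⌝ ≡ ⌜ β ⌝

  private
    variable
      A B C D E : Obj
      f f' f'' g g' g'' h h' k k' : Hom A B

  ≋⇒≡ : {α β : Cell f g} → α ≋ β → α ≡ β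
  ≋⇒≡ refl = refl

  subst₂-≋ : (p : f ≡ f') (q : g ≡ g') {α : Cell f g} → subst₂ Cell p q α ≋ α
  subst₂-≋ refl refl = refl

  subst-≋ : (q : g ≡ g') {α : Cell f g} → subst (Cell f) q α ≋ α
  subst-≋ refl = refl

  subst-· : (q : h ≡ h') {β : Cell g h} {α : Cell f g} →
            subst (Cell f) q (β · α) ≡ subst (Cell g) q β · α
  subst-· refl = refl

  subst₂-≡⇒≋ : (p : f ≡ f') (q : g ≡ g') {α : Cell f g} {β : Cell f' g'} →
               subst₂ Cell p q α ≡ β → α ≋ β
  subst₂-≡⇒≋ refl refl refl = refl

  ≅⇒≋ : {α : Cell f g} {β : Cell f' g'} → f ≡ f' → g ≡ g' → α ≅ β → α ≋ β
  ≅⇒≋ refl refl refl = refl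

  id₂-cong : f ≡ g → id₂ f ≋ id₂ g
  id₂-cong refl = refl

  ·-cong : {β : Cell {A} {B} g h} {α : Cell f g} {β' : Cell g' h'} {α' : Cell f' g'} →
           β ≋ β' → α ≋ α' → β · α ≋ β' · α'
  ·-cong refl refl = refl

  ∗-cong : {β : Cell {B} {C} g g'} {β' : Cell h h'} {α : Cell {A} f f'} {α' : Cell k k'} →
           β ≋ β' → α ≋ α' → β ∗ α ≋ β' ∗ α'
  ∗-cong refl refl = refl

  ⟨⟩₂-cong : {α : Cell {D} {A} f f'} {α' : Cell g g'} {β : Cell {D} {B} h h'} {β' : Cell k k'} →
             α ≋ α' → β ≋ β' → ⟨ α , β ⟩₂ ≋ ⟨ α' , β' ⟩₂
  ⟨⟩₂-cong refl refl = refl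

  cur₂-cong : {α : Cell {D × A} {B} f f'} {α' : Cell g g'} → α ≋ α' → cur₂ α ≋ cur₂ α'
  cur₂-cong refl = refl

  ·-identˡ≋ : {α : Cell {A} {B} f g} → id₂ g · α ≋ α
  ·-identˡ≋ = cong ⌜_⌝ ·-identˡ

  ·-identʳ≋ : {α : Cell {A} {B} f g} → α · id₂ f ≋ α
  ·-identʳ≋ = cong ⌜_⌝ ·-identʳ

  interchange≋ : {β' : Cell {B} {C} g' g''} {β : Cell g g'} {α' : Cell {A} f' f''} {α : Cell f f'} →
                 (β' · β) ∗ (α' · α) ≋ (β' ∗ α') · (β ∗ α)
  interchange≋ = cong ⌜_⌝ interchange

  ∗-id≋ : {g : Hom B C} {f : Hom A B} → id₂ g ∗ id₂ f ≋ id₂ (g ∘ f)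
  ∗-id≋ = cong ⌜_⌝ ∗-id

  ∗-assoc≋ : {γ : Cell {C} {D} h h'} {β : Cell {B} g g'} {α : Cell {A} f f'} →
             (γ ∗ β) ∗ α ≋ γ ∗ (β ∗ α)
  ∗-assoc≋ = subst₂-≡⇒≋ assoc assoc ∗-assoc

  ∗-identʳ≋ : {α : Cell {A} {B} f f'} → α ∗ id₂ id ≋ α
  ∗-identʳ≋ = subst₂-≡⇒≋ identʳ identʳ ∗-identʳ

  ×-β₁≋ : {α : Cell {D} {A} f f'} {β : Cell {D} {B} g g'} → id₂ π₁ ∗ ⟨ α , β ⟩₂ ≋ α
  ×-β₁≋ = subst₂-≡⇒≋ ×-β₁ ×-β₁ ×-β₁₂

  ×-β₂≋ : {α : Cell {D} {A} f f'} {β : Cell {D} {B} g g'} → id₂ π₂ ∗ ⟨ α , β ⟩₂ ≋ β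
  ×-β₂≋ = subst₂-≡⇒≋ ×-β₂ ×-β₂ ×-β₂₂

  ×-η≋ : {γ : Cell {D} {A × B} h h'} → ⟨ id₂ π₁ ∗ γ , id₂ π₂ ∗ γ ⟩₂ ≋ γ
  ×-η≋ = subst₂-≡⇒≋ ×-η ×-η ×-η₂

  !-unique₂ : {f g : Hom D 𝟏} (α : Cell f g) → α ≋ id₂ (! {D})
  !-unique₂ {f = f} {g} α with !-η f | !-η g
  ... | refl | refl = cong ⌜_⌝ (!-η₂ α)

  ∗-assoc-cong : {γ : Cell {C} {D} h h'} {β : Cell {B} g g'} {α : Cell {A} f f'} {α' : Cell k k'} →
                 α' ≋ β ∗ α → γ ∗ α' ≋ (γ ∗ β) ∗ α
  ∗-assoc-cong p = trans (∗-cong refl p) (sym ∗-assoc≋)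

  ⟨⟩₂-∗ : {α : Cell {D} {A} f f'} {β : Cell {D} {B} g g'} {γ : Cell {C} h h'} →
          ⟨ α , β ⟩₂ ∗ γ ≋ ⟨ α ∗ γ , β ∗ γ ⟩₂
  ⟨⟩₂-∗ {α = α} {β} {γ} = begin
    ⌜ ⟨ α , β ⟩₂ ∗ γ ⌝
      ≡⟨ sym ×-η≋ ⟩
    ⌜ ⟨ id₂ π₁ ∗ (⟨ α , β ⟩₂ ∗ γ) , id₂ π₂ ∗ (⟨ α , β ⟩₂ ∗ γ) ⟩₂ ⌝
      ≡⟨ ⟨⟩₂-cong (trans (sym ∗-assoc≋) (∗-cong ×-β₁≋ refl)) (trans (sym ∗-assoc≋) (∗-cong ×-β₂≋ refl)) ⟩
    ⌜ ⟨ α ∗ γ , β ∗ γ ⟩₂ ⌝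
      ∎

  ⟨⟩₂-∗-cong : {α : Cell {D} {A} f f'} {β : Cell {D} {B} g g'} {γ : Cell {C} h h'}
               {α' : Cell {C} {A} f'' g''} {β' : Cell {C} {B} k k'} →
               α' ≋ α ∗ γ → β' ≋ β ∗ γ → ⟨ α' , β' ⟩₂ ≋ ⟨ α , β ⟩₂ ∗ γ
  ⟨⟩₂-∗-cong p q = trans (⟨⟩₂-cong p q) (sym ⟨⟩₂-∗)

  id₂-∘ : {g : Hom B C} {f : Hom A B} {h : Hom A C} → h ≡ g ∘ f → id₂ h ≋ id₂ g ∗ id₂ f
  id₂-∘ p = trans (id₂-cong p) (sym ∗-id≋)

  ⟨⟩₂-id : {f : Hom D A} {g : Hom D B} → ⟨ id₂ f , id₂ g ⟩₂ ≋ id₂ ⟨ f , g ⟩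
  ⟨⟩₂-id {f = f} {g} = begin
    ⌜ ⟨ id₂ f , id₂ g ⟩₂ ⌝                                     ≡⟨ ⟨⟩₂-cong (id₂-∘ (sym ×-β₁)) (id₂-∘ (sym ×-β₂)) ⟩
    ⌜ ⟨ id₂ π₁ ∗ id₂ ⟨ f , g ⟩ , id₂ π₂ ∗ id₂ ⟨ f , g ⟩ ⟩₂ ⌝ ≡⟨ ×-η≋ ⟩
    ⌜ id₂ ⟨ f , g ⟩ ⌝                                         ∎

  id₂∗-· : {k : Hom B C} {β : Cell {A} g h} {α : Cell f g} → id₂ k ∗ (β · α) ≋ (id₂ k ∗ β) · (id₂ k ∗ α)
  id₂∗-· = trans (∗-cong (sym ·-identˡ≋) refl) interchange≋

  ·-∗id₂ : {k : Hom A B} {β : Cell {B} {C} g h} {α : Cell f g} → (β · α) ∗ id₂ k ≋ (β ∗ id₂ k) · (α ∗ id₂ k)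
  ·-∗id₂ = trans (∗-cong refl (sym ·-identˡ≋)) interchange≋

  ⟨⟩₂-· : {α' : Cell {D} {A} f' f''} {α : Cell f f'} {β' : Cell {D} {B} g' g''} {β : Cell g g'} →
          ⟨ α' · α , β' · β ⟩₂ ≋ ⟨ α' , β' ⟩₂ · ⟨ α , β ⟩₂
  ⟨⟩₂-· {α' = α'} {α} {β'} {β} = begin
    ⌜ ⟨ α' · α , β' · β ⟩₂ ⌝
      ≡⟨ ⟨⟩₂-cong (sym (trans id₂∗-· (·-cong ×-β₁≋ ×-β₁≋))) (sym (trans id₂∗-· (·-cong ×-β₂≋ ×-β₂≋))) ⟩
    ⌜ ⟨ id₂ π₁ ∗ (⟨ α' , β' ⟩₂ · ⟨ α , β ⟩₂) , id₂ π₂ ∗ (⟨ α' , β' ⟩₂ · ⟨ α , β ⟩₂) ⟩₂ ⌝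
      ≡⟨ ×-η≋ ⟩
    ⌜ ⟨ α' , β' ⟩₂ · ⟨ α , β ⟩₂ ⌝
      ∎

  ·-∗id₂-cong : {k : Hom A B} {β : Cell {B} {C} g h} {α : Cell f g} {β' : Cell g' h'} {α' : Cell f' g'} →
                β' ≋ β ∗ id₂ k → α' ≋ α ∗ id₂ k → β' · α' ≋ (β · α) ∗ id₂ k
  ·-∗id₂-cong p q = trans (·-cong p q) (sym ·-∗id₂)

  id₂∗-assoc-cong : {k : Hom C D} {g : Hom B C} {γ : Cell {A} f f'} {α' : Cell h h'} →
                    α' ≋ id₂ g ∗ γ → id₂ k ∗ α' ≋ id₂ (k ∘ g) ∗ γ
  id₂∗-assoc-cong p = trans (∗-assoc-cong p) (∗-cong ∗-id≋ refl)

  ⟨⟩₂-id₂∗-cong : {f : Hom C A} {g : Hom C B} {γ : Cell {D} h h'}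
                  {α' : Cell {D} {A} k k'} {β' : Cell {D} {B} g' g''} →
                  α' ≋ id₂ f ∗ γ → β' ≋ id₂ g ∗ γ → ⟨ α' , β' ⟩₂ ≋ id₂ ⟨ f , g ⟩ ∗ γ
  ⟨⟩₂-id₂∗-cong p q = trans (⟨⟩₂-∗-cong p q) (∗-cong ⟨⟩₂-id refl)

  _×₂id : ∀ {A} {h h' : Hom D E} → Cell h h' → Cell {D × A} ⟨ h ∘ π₁ , π₂ ⟩ ⟨ h' ∘ π₁ , π₂ ⟩
  γ ×₂id = ⟨ γ ∗ id₂ π₁ , id₂ π₂ ⟩₂

  ×₂id-id : ∀ {A} {h : Hom D E} → _×₂id {A = A} (id₂ h) ≋ id₂ ⟨ h ∘ π₁ , π₂ ⟩
  ×₂id-id = trans (⟨⟩₂-cong ∗-id≋ refl) ⟨⟩₂-id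

  ×₂id-· : ∀ {A} {γ' : Cell {D} {E} g h} {γ : Cell f g} → _×₂id {A = A} (γ' · γ) ≋ (γ' ×₂id) · (γ ×₂id)
  ×₂id-· = trans (⟨⟩₂-cong ·-∗id₂ (sym ·-identˡ≋)) ⟨⟩₂-·

  ×₂id-∗ : ∀ {A} {β : Cell {D} {E} g g'} {γ : Cell {C} f f'} →
           _×₂id {A = A} β ∗ (γ ×₂id) ≋ (β ∗ γ) ×₂id
  ×₂id-∗ {β = β} {γ} = begin
    ⌜ (β ×₂id) ∗ (γ ×₂id) ⌝                                        ≡⟨ ⟨⟩₂-∗ ⟩
    ⌜ ⟨ (β ∗ id₂ π₁) ∗ (γ ×₂id) , id₂ π₂ ∗ (γ ×₂id) ⟩₂ ⌝           ≡⟨ ⟨⟩₂-cong ∗-assoc≋ ×-β₂≋ ⟩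
    ⌜ ⟨ β ∗ (id₂ π₁ ∗ (γ ×₂id)) , id₂ π₂ ⟩₂ ⌝                       ≡⟨ ⟨⟩₂-cong (∗-assoc-cong ×-β₁≋) refl ⟩
    ⌜ (β ∗ γ) ×₂id ⌝                                               ∎

  id₂-×₂id : ∀ {A} {h : Hom D E} {h' : Hom (D × A) E} → h' ≡ h ∘ π₁ → id₂ ⟨ h' , π₂ ⟩ ≋ _×₂id {A = A} (id₂ h)
  id₂-×₂id p = trans (id₂-cong (cong₂ ⟨_,_⟩ p refl)) (sym ×₂id-id)

  uncur₂ : ∀ {A B} {g g' : Hom D (B ^ A)} → Cell g g' → Cell (ev ∘ ⟨ g ∘ π₁ , π₂ ⟩) (ev ∘ ⟨ g' ∘ π₁ , π₂ ⟩)
  uncur₂ γ = id₂ ev ∗ (γ ×₂id)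

  cur-β≋ : {α : Cell {D × A} {B} f f'} → uncur₂ (cur₂ α) ≋ α
  cur-β≋ = subst₂-≡⇒≋ cur-β cur-β cur-β₂

  cur-η≋ : {γ : Cell {D} {B ^ A} g g'} → cur₂ (uncur₂ γ) ≋ γ
  cur-η≋ = subst₂-≡⇒≋ cur-η cur-η cur-η₂

  uncur₂-· : {γ' : Cell {D} {B ^ A} g h} {γ : Cell f g} → uncur₂ (γ' · γ) ≋ uncur₂ γ' · uncur₂ γ
  uncur₂-· = trans (∗-cong refl ×₂id-·) id₂∗-·

  cur₂-· : {β : Cell {D × A} {B} g h} {α : Cell f g} → cur₂ (β · α) ≋ cur₂ β · cur₂ α
  cur₂-· {β = β} {α} = begin
    ⌜ cur₂ (β · α) ⌝                              ≡⟨ cur₂-cong (sym (·-cong cur-β≋ cur-β≋)) ⟩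
    ⌜ cur₂ (uncur₂ (cur₂ β) · uncur₂ (cur₂ α)) ⌝ ≡⟨ cur₂-cong (sym uncur₂-·) ⟩
    ⌜ cur₂ (uncur₂ (cur₂ β · cur₂ α)) ⌝          ≡⟨ cur-η≋ ⟩
    ⌜ cur₂ β · cur₂ α ⌝                           ∎

  cur₂-id : {f : Hom (D × A) B} → cur₂ (id₂ f) ≋ id₂ (cur f)
  cur₂-id {f = f} = begin
    ⌜ cur₂ (id₂ f) ⌝                ≡⟨ cur₂-cong (sym uncur₂-id) ⟩
    ⌜ cur₂ (uncur₂ (id₂ (cur f))) ⌝ ≡⟨ cur-η≋ ⟩
    ⌜ id₂ (cur f) ⌝                 ∎
    where
    uncur₂-id : uncur₂ (id₂ (cur f)) ≋ id₂ f
    uncur₂-id = trans (∗-cong refl ×₂id-id) (trans ∗-id≋ (id₂-cong cur-β))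

  cur₂-∗ : {α : Cell {D × A} {B} f f'} {γ : Cell {C} h h'} → cur₂ α ∗ γ ≋ cur₂ (α ∗ (γ ×₂id))
  cur₂-∗ {α = α} {γ} = begin
    ⌜ cur₂ α ∗ γ ⌝                                ≡⟨ sym cur-η≋ ⟩
    ⌜ cur₂ (id₂ ev ∗ ((cur₂ α ∗ γ) ×₂id)) ⌝       ≡⟨ cur₂-cong (∗-cong refl (sym ×₂id-∗)) ⟩
    ⌜ cur₂ (id₂ ev ∗ ((cur₂ α ×₂id) ∗ (γ ×₂id))) ⌝ ≡⟨ cur₂-cong (sym ∗-assoc≋) ⟩
    ⌜ cur₂ (uncur₂ (cur₂ α) ∗ (γ ×₂id)) ⌝         ≡⟨ cur₂-cong (∗-cong cur-β≋ refl) ⟩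
    ⌜ cur₂ (α ∗ (γ ×₂id)) ⌝                       ∎

  ev-cur₂ : {α : Cell {D × A} {B} f f'} {β : Cell {D} {A} g g'} →
            id₂ ev ∗ ⟨ cur₂ α , β ⟩₂ ≋ α ∗ ⟨ id₂ id , β ⟩₂
  ev-cur₂ {α = α} {β} = begin
    ⌜ id₂ ev ∗ ⟨ cur₂ α , β ⟩₂ ⌝                       ≡⟨ ∗-cong refl (sym ×₂id-⟨id,-⟩) ⟩
    ⌜ id₂ ev ∗ ((cur₂ α ×₂id) ∗ ⟨ id₂ id , β ⟩₂) ⌝     ≡⟨ sym ∗-assoc≋ ⟩
    ⌜ uncur₂ (cur₂ α) ∗ ⟨ id₂ id , β ⟩₂ ⌝              ≡⟨ ∗-cong cur-β≋ refl ⟩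
    ⌜ α ∗ ⟨ id₂ id , β ⟩₂ ⌝                            ∎
    where
    ×₂id-⟨id,-⟩ : (cur₂ α ×₂id) ∗ ⟨ id₂ id , β ⟩₂ ≋ ⟨ cur₂ α , β ⟩₂
    ×₂id-⟨id,-⟩ = trans ⟨⟩₂-∗ (⟨⟩₂-cong (trans ∗-assoc≋ (trans (∗-cong refl ×-β₁≋) ∗-identʳ≋)) ×-β₂≋)

module Interpretation {o ℓ c : Level} (𝒞 : CC2Cat o ℓ c) where
  open CC2Cat 𝒞
  open Syntax 𝒞
  open CellCalculus 𝒞
  open ≡-Reasoning

  h₂-subst₂ : ∀ {Γ A} {M M' N N' : Tm Γ A} (p : M ≡ M') (q : N ≡ N') (P : Red Γ A M N) →
              h₂ (subst₂ (Red Γ A) p q P) ≋ h₂ P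
  h₂-subst₂ refl refl P = refl

  h₂-rule : ∀ {Γ G A σ τ} (M N : Tm G A) (α : Cell (h₁ M) (h₁ N)) (Ps : Reds Γ G σ τ) →
            h₂ (rule M N α Ps) ≋ α ∗ h₂s Ps
  h₂-rule {σ = σ} {τ} M N α Ps = subst₂-≋ (sym (h₁-sub σ M)) (sym (h₁-sub τ N))

  h₂-rule-∗ : ∀ {Γ Γ' G A σ τ σ' τ'} (M N : Tm G A) (α : Cell (h₁ M) (h₁ N))
              (Ps : Reds Γ G σ τ) (Ps' : Reds Γ' G σ' τ') {f f' : Hom (h₀c Γ') (h₀c Γ)} {γ : Cell f f'} →
              h₂s Ps' ≋ h₂s Ps ∗ γ → h₂ (rule M N α Ps') ≋ h₂ (rule M N α Ps) ∗ γ
  h₂-rule-∗ M N α Ps Ps' p =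
    trans (h₂-rule M N α Ps') (trans (∗-assoc-cong p) (∗-cong (sym (h₂-rule M N α Ps)) refl))

  h₂-tm   : ∀ {Γ A} (M : Tm Γ A) → h₂ (tm M) ≋ id₂ (h₁ M)
  h₂s-tms : ∀ {Γ G} (σ : Sub Γ G) → h₂s (tms σ) ≋ id₂ (h₁s σ)
  h₂-tm (var x)    = refl
  h₂-tm unit       = refl
  h₂-tm (pair M N) = trans (⟨⟩₂-cong (h₂-tm M) (h₂-tm N)) ⟨⟩₂-id
  h₂-tm (fst M)    = trans (∗-cong refl (h₂-tm M)) ∗-id≋
  h₂-tm (snd M)    = trans (∗-cong refl (h₂-tm M)) ∗-id≋
  h₂-tm (lam M)    = trans (cur₂-cong (h₂-tm M)) cur₂-id
  h₂-tm (app M N)  = trans (∗-cong refl (trans (⟨⟩₂-cong (h₂-tm M) (h₂-tm N)) ⟨⟩₂-id)) ∗-id≋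
  h₂-tm (op f σ)   = trans (∗-cong refl (h₂s-tms σ)) ∗-id≋
  h₂s-tms []      = refl
  h₂s-tms (σ , M) = trans (⟨⟩₂-cong (h₂s-tms σ) (h₂-tm M)) ⟨⟩₂-id

  h₂-renR   : ∀ {Γ Δ A M N} (ρ : Ren Γ Δ) (P : Red Δ A M N) → h₂ (renR ρ P) ≋ h₂ P ∗ id₂ (h₁R ρ)
  h₂s-renRs : ∀ {Γ Δ G σ τ} (ρ : Ren Γ Δ) (Ps : Reds Δ G σ τ) → h₂s (renRs ρ Ps) ≋ h₂s Ps ∗ id₂ (h₁R ρ)
  h₂-renR ρ (var x)      = id₂-∘ (h₁v-lookupR ρ x)
  h₂-renR ρ unit         = sym (!-unique₂ _)
  h₂-renR ρ (op f Ps)    = ∗-assoc-cong (h₂s-renRs ρ Ps)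
  h₂-renR ρ (rule {σ = σ} {τ} M N α Ps) =
    trans (h₂-subst₂ (sym (ren-sub ρ σ M)) (sym (ren-sub ρ τ N)) (rule M N α (renRs ρ Ps)))
          (h₂-rule-∗ M N α Ps (renRs ρ Ps) (h₂s-renRs ρ Ps))
  h₂-renR ρ (P ⨾[ e ] Q) =
    ·-∗id₂-cong (h₂-renR ρ Q) (trans (subst-≋ _) (trans (h₂-renR ρ P) (∗-cong (sym (subst-≋ _)) refl)))
  h₂-renR ρ (lam P)      =
    trans (cur₂-cong (trans (h₂-renR (liftR ρ) P) (∗-cong refl (id₂-×₂id (h₁R-wkR ρ))))) (sym cur₂-∗)
  h₂-renR ρ (app P Q)    = ∗-assoc-cong (⟨⟩₂-∗-cong (h₂-renR ρ P) (h₂-renR ρ Q))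
  h₂-renR ρ (pair P Q)   = ⟨⟩₂-∗-cong (h₂-renR ρ P) (h₂-renR ρ Q)
  h₂-renR ρ (fst P)      = ∗-assoc-cong (h₂-renR ρ P)
  h₂-renR ρ (snd P)      = ∗-assoc-cong (h₂-renR ρ P)
  h₂s-renRs ρ []       = sym (!-unique₂ _)
  h₂s-renRs ρ (Ps , P) = ⟨⟩₂-∗-cong (h₂s-renRs ρ Ps) (h₂-renR ρ P)

  h₂-renR-wk : ∀ {Γ A B M N} (P : Red Γ A M N) → h₂ (renR (wk {A = B}) P) ≋ h₂ P ∗ id₂ π₁
  h₂-renR-wk {Γ} {B = B} P = trans (h₂-renR wk P) (∗-cong refl (id₂-cong (h₁R-wk {Γ} {B})))

  h₂s-renRs-wk : ∀ {Γ B G σ τ} (Ps : Reds Γ G σ τ) → h₂s (renRs (wk {A = B}) Ps) ≋ h₂s Ps ∗ id₂ π₁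
  h₂s-renRs-wk {Γ} {B} Ps = trans (h₂s-renRs wk Ps) (∗-cong refl (id₂-cong (h₁R-wk {Γ} {B})))

  h₂-subR   : ∀ {Γ Δ A M N} (σ : Sub Γ Δ) (P : Red Δ A M N) → h₂ (subR σ P) ≋ h₂ P ∗ id₂ (h₁s σ)
  h₂s-subRs : ∀ {Γ Δ G τ τ'} (σ : Sub Γ Δ) (Ps : Reds Δ G τ τ') → h₂s (subRs σ Ps) ≋ h₂s Ps ∗ id₂ (h₁s σ)
  h₂-subR σ (var x)      = trans (h₂-tm (lookup σ x)) (id₂-∘ (h₁-lookup σ x))
  h₂-subR σ unit         = sym (!-unique₂ _)
  h₂-subR σ (op f Ps)    = ∗-assoc-cong (h₂s-subRs σ Ps)
  h₂-subR σ (rule {σ = τ} {τ'} M N α Ps) =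
    trans (h₂-subst₂ (sym (sub-sub σ τ M)) (sym (sub-sub σ τ' N)) (rule M N α (subRs σ Ps)))
          (h₂-rule-∗ M N α Ps (subRs σ Ps) (h₂s-subRs σ Ps))
  h₂-subR σ (P ⨾[ e ] Q) =
    ·-∗id₂-cong (h₂-subR σ Q) (trans (subst-≋ _) (trans (h₂-subR σ P) (∗-cong (sym (subst-≋ _)) refl)))
  h₂-subR σ (lam P)      =
    trans (cur₂-cong (trans (h₂-subR (liftS σ) P) (∗-cong refl (id₂-×₂id (h₁s-wk σ))))) (sym cur₂-∗)
  h₂-subR σ (app P Q)    = ∗-assoc-cong (⟨⟩₂-∗-cong (h₂-subR σ P) (h₂-subR σ Q))
  h₂-subR σ (pair P Q)   = ⟨⟩₂-∗-cong (h₂-subR σ P) (h₂-subR σ Q)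
  h₂-subR σ (fst P)      = ∗-assoc-cong (h₂-subR σ P)
  h₂-subR σ (snd P)      = ∗-assoc-cong (h₂-subR σ P)
  h₂s-subRs σ []       = sym (!-unique₂ _)
  h₂s-subRs σ (Ps , P) = ⟨⟩₂-∗-cong (h₂s-subRs σ Ps) (h₂-subR σ P)

  h₂-lookupRs : ∀ {Γ Δ A σ τ} (Qs : Reds Γ Δ σ τ) (x : Δ ∋ A) → h₂ (lookupRs Qs x) ≋ id₂ (h₁v x) ∗ h₂s Qs
  h₂-lookupRs (Qs , Q) zero    = sym ×-β₂≋
  h₂-lookupRs (Qs , Q) (suc x) = trans (h₂-lookupRs Qs x) (id₂∗-assoc-cong (sym ×-β₁≋))

  h₂-tmR   : ∀ {Γ Δ A σ τ} (M : Tm Δ A) (Qs : Reds Γ Δ σ τ) → h₂ (tmR M Qs) ≋ id₂ (h₁ M) ∗ h₂s Qs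
  h₂s-tmRs : ∀ {Γ Δ G σ τ} (ν : Sub Δ G) (Qs : Reds Γ Δ σ τ) → h₂s (tmRs ν Qs) ≋ id₂ (h₁s ν) ∗ h₂s Qs
  h₂-tmR (var x)    Qs = h₂-lookupRs Qs x
  h₂-tmR unit       Qs = sym (!-unique₂ _)
  h₂-tmR (pair M N) Qs = ⟨⟩₂-id₂∗-cong (h₂-tmR M Qs) (h₂-tmR N Qs)
  h₂-tmR (fst M)    Qs = id₂∗-assoc-cong (h₂-tmR M Qs)
  h₂-tmR (snd M)    Qs = id₂∗-assoc-cong (h₂-tmR M Qs)
  h₂-tmR (lam M)    Qs =
    trans (cur₂-cong (trans (h₂-tmR M (liftRs Qs)) (∗-cong refl (⟨⟩₂-cong (h₂s-renRs-wk Qs) refl))))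
          (trans (sym cur₂-∗) (∗-cong cur₂-id refl))
  h₂-tmR (app M N)  Qs = id₂∗-assoc-cong (⟨⟩₂-id₂∗-cong (h₂-tmR M Qs) (h₂-tmR N Qs))
  h₂-tmR (op f ν)   Qs = id₂∗-assoc-cong (h₂s-tmRs ν Qs)
  h₂s-tmRs []      Qs = sym (!-unique₂ _)
  h₂s-tmRs (ν , M) Qs = ⟨⟩₂-id₂∗-cong (h₂s-tmRs ν Qs) (h₂-tmR M Qs)

  h₂s-⨾s : ∀ {Γ G σ σ' τ} (Ps : Reds Γ G σ σ') (Qs : Reds Γ G σ' τ) → h₂s (Ps ⨾s Qs) ≋ h₂s Qs · h₂s Ps
  h₂s-⨾s []       []       = sym ·-identˡ≋
  h₂s-⨾s (Ps , P) (Qs , Q) = trans (⟨⟩₂-cong (h₂s-⨾s Ps Qs) refl) ⟨⟩₂-·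

  h₂-[/0] : ∀ {Γ A B M M' N N'} (P : Red (Γ ▸ A) B M M') (Q : Red Γ A N N') →
            h₂ (P [ Q /0]) ≋ h₂ P ∗ ⟨ id₂ id , h₂ Q ⟩₂
  h₂-[/0] {Γ} {M' = M'} {N = N} P Q = begin
    ⌜ h₂ (tmR M' (tms (idS {Γ}) , Q)) · h₂ (subR (idS {Γ} , N) P) ⌝
      ≡⟨ ·-cong (h₂-tmR M' (tms (idS {Γ}) , Q)) (h₂-subR (idS {Γ} , N) P) ⟩
    ⌜ (id₂ (h₁ M') ∗ ⟨ h₂s (tms (idS {Γ})) , h₂ Q ⟩₂) · (h₂ P ∗ id₂ (h₁s (idS {Γ} , N))) ⌝
      ≡⟨ sym interchange≋ ⟩
    ⌜ (id₂ (h₁ M') · h₂ P) ∗ (⟨ h₂s (tms (idS {Γ})) , h₂ Q ⟩₂ · id₂ (h₁s (idS {Γ} , N))) ⌝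
      ≡⟨ ∗-cong ·-identˡ≋ ·-identʳ≋ ⟩
    ⌜ h₂ P ∗ ⟨ h₂s (tms (idS {Γ})) , h₂ Q ⟩₂ ⌝
      ≡⟨ ∗-cong refl (⟨⟩₂-cong (trans (h₂s-tms (idS {Γ})) (id₂-cong (h₁s-idS {Γ}))) refl) ⟩
    ⌜ h₂ P ∗ ⟨ id₂ id , h₂ Q ⟩₂ ⌝
      ∎

  h₂-⨾-assoc : ∀ {Γ A M N N₁ K K₁ L} (P : Red Γ A M N) (Q : Red Γ A N₁ K) (R : Red Γ A K₁ L)
               (e : N ≈βη N₁) (e' : K ≈βη K₁) → h₂ ((P ⨾[ e ] Q) ⨾[ e' ] R) ≋ h₂ (P ⨾[ e ] (Q ⨾[ e' ] R))
  h₂-⨾-assoc P Q R e e' = trans (·-cong refl (cong ⌜_⌝ (subst-· (sound e')))) (cong ⌜_⌝ (sym ·-assoc))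

  h₂-rule-⨾ˡ : ∀ {Γ G A σ₁ σ₂ σ₃} (M₁ M₂ : Tm G A) (α : Cell (h₁ M₁) (h₁ M₂))
               (Ps : Reds Γ G σ₁ σ₂) (Qs : Reds Γ G σ₂ σ₃) (e : sub σ₂ M₁ ≈βη sub σ₂ M₁) →
               h₂ (rule M₁ M₂ α (Ps ⨾s Qs)) ≋ h₂ (tmR M₁ Ps ⨾[ e ] rule M₁ M₂ α Qs)
  h₂-rule-⨾ˡ M₁ M₂ α Ps Qs e =
    trans (h₂-rule M₁ M₂ α (Ps ⨾s Qs))
      (trans (∗-cong (sym ·-identʳ≋) (h₂s-⨾s Ps Qs))
      (trans interchange≋
             (·-cong (sym (h₂-rule M₁ M₂ α Qs)) (sym (trans (subst-≋ (sound e)) (h₂-tmR M₁ Ps))))))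

  h₂-rule-⨾ʳ : ∀ {Γ G A σ₁ σ₂ σ₃} (M₁ M₂ : Tm G A) (α : Cell (h₁ M₁) (h₁ M₂))
               (Ps : Reds Γ G σ₁ σ₂) (Qs : Reds Γ G σ₂ σ₃) (e : sub σ₂ M₂ ≈βη sub σ₂ M₂) →
               h₂ (rule M₁ M₂ α (Ps ⨾s Qs)) ≋ h₂ (rule M₁ M₂ α Ps ⨾[ e ] tmR M₂ Qs)
  h₂-rule-⨾ʳ M₁ M₂ α Ps Qs e =
    trans (h₂-rule M₁ M₂ α (Ps ⨾s Qs))
      (trans (∗-cong (sym ·-identˡ≋) (h₂s-⨾s Ps Qs))
      (trans interchange≋
             (·-cong (sym (h₂-tmR M₂ Qs)) (sym (trans (subst-≋ (sound e)) (h₂-rule M₁ M₂ α Ps))))))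

  h₂-≈   : ∀ {Γ A M N M' N'} {P : Red Γ A M N} {Q : Red Γ A M' N'} → P ≈ Q → h₂ P ≋ h₂ Q
  h₂s-≈s : ∀ {Γ G σ τ σ' τ'} {Ps : Reds Γ G σ τ} {Qs : Reds Γ G σ' τ'} → Ps ≈s Qs → h₂s Ps ≋ h₂s Qs
  h₂-≈ ≈-refl             = refl
  h₂-≈ (≈-sym p)          = sym (h₂-≈ p)
  h₂-≈ (≈-trans p q)      = trans (h₂-≈ p) (h₂-≈ q)
  h₂-≈ (op-≈ f ps)        = ∗-cong refl (h₂s-≈s ps)
  h₂-≈ (rule-≈ {M = M} {N} {M'} {N'} {α} {α'} {Ps} {Qs} eM eN a ps) =
    trans (h₂-rule M N α Ps) (trans (∗-cong (≅⇒≋ (sound eM) (sound eN) a) (h₂s-≈s ps)) (sym (h₂-rule M' N' α' Qs)))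
  h₂-≈ (⨾-≈ p q)          = ·-cong (h₂-≈ q) (trans (subst-≋ _) (trans (h₂-≈ p) (sym (subst-≋ _))))
  h₂-≈ (lam-≈ p)          = cur₂-cong (h₂-≈ p)
  h₂-≈ (app-≈ p q)        = ∗-cong refl (⟨⟩₂-cong (h₂-≈ p) (h₂-≈ q))
  h₂-≈ (pair-≈ p q)       = ⟨⟩₂-cong (h₂-≈ p) (h₂-≈ q)
  h₂-≈ (fst-≈ p)          = ∗-cong refl (h₂-≈ p)
  h₂-≈ (snd-≈ p)          = ∗-cong refl (h₂-≈ p)
  h₂-≈ (⨾-assoc {P = P} {Q} {R} {e} {e'}) = h₂-⨾-assoc P Q R e e'
  h₂-≈ (⨾-idˡ {M = M} {e = e}) =
    trans (·-cong refl (trans (subst-≋ (sound e)) (trans (h₂-tm M) (id₂-cong (sound e))))) ·-identʳ≋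
  h₂-≈ (⨾-idʳ {N' = N'} {e = e}) = trans (·-cong (h₂-tm N') refl) (trans ·-identˡ≋ (subst-≋ (sound e)))
  h₂-≈ (β⇒ {P = P} {Q}) = trans ev-cur₂ (sym (h₂-[/0] P Q))
  h₂-≈ (η⇒ {P = P}) =
    sym (trans (cur₂-cong (∗-cong refl (⟨⟩₂-cong (h₂-renR-wk P) refl))) cur-η≋)
  h₂-≈ β⊗₁ = ×-β₁≋
  h₂-≈ β⊗₂ = ×-β₂≋
  h₂-≈ η⊗  = sym ×-η≋
  h₂-≈ η𝟙  = !-unique₂ _
  h₂-≈ (rule-⨾ˡ {M₁ = M₁} {M₂} {α} {Ps} {Qs} {e}) = h₂-rule-⨾ˡ M₁ M₂ α Ps Qs e
  h₂-≈ (rule-⨾ʳ {M₁ = M₁} {M₂} {α} {Ps} {Qs} {e}) = h₂-rule-⨾ʳ M₁ M₂ α Ps Qs e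
  h₂-≈ (op-⨾ {Ps = Ps} {Qs} {e}) =
    trans (∗-cong refl (h₂s-⨾s Ps Qs)) (trans id₂∗-· (·-cong refl (sym (subst-≋ (sound e)))))
  h₂-≈ (lam-⨾ {e = e} {e'}) =
    trans cur₂-· (·-cong refl (trans (cur₂-cong (subst-≋ (sound e))) (sym (subst-≋ (sound e')))))
  h₂-≈ (app-⨾ {e = e} {e'} {e''}) =
    trans (∗-cong refl ⟨⟩₂-·) (trans id₂∗-· (·-cong refl
      (trans (∗-cong refl (⟨⟩₂-cong (subst-≋ (sound e)) (subst-≋ (sound e')))) (sym (subst-≋ (sound e''))))))
  h₂-≈ (pair-⨾ {e = e} {e'} {e''}) =
    trans ⟨⟩₂-· (·-cong refl
      (trans (⟨⟩₂-cong (subst-≋ (sound e)) (subst-≋ (sound e'))) (sym (subst-≋ (sound e'')))))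
  h₂-≈ (fst-⨾ {e = e} {e'}) =
    trans id₂∗-· (·-cong refl (trans (∗-cong refl (subst-≋ (sound e))) (sym (subst-≋ (sound e')))))
  h₂-≈ (snd-⨾ {e = e} {e'}) =
    trans id₂∗-· (·-cong refl (trans (∗-cong refl (subst-≋ (sound e))) (sym (subst-≋ (sound e')))))
  h₂s-≈s []       = refl
  h₂s-≈s (ps , p) = ⟨⟩₂-cong (h₂s-≈s ps) (h₂-≈ p)

lemma7p2 : ∀ {o ℓ c : Level} (𝒞 : CC2Cat o ℓ c) →
    let open Syntax 𝒞 in
    ∀ {Γ : Ctx} {A : Ty} {M N : Tm Γ A} {P Q : Red Γ A M N} →
      P ≈ Q → h₂ P ≡ h₂ Q
lemma7p2 𝒞 P≈Q = CellCalculus.≋⇒≡ 𝒞 (Interpretation.h₂-≈ 𝒞 P≈Q)
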